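{- (i) If $r\in\{3,4\}$ and $n\ge r+1$, then $t_2(n,r)\le \frac{5}{2}n-5$. (ii) If $r=5$ and $n\ge 7$, then $t_2(n,5)\le \frac{7n-19}{3}$. (iii) If $6\le r\le n-3$, then $t_2(n,r)\le 2n-r+2$.
   Context: All graphs are finite, simple and undirected. An $r$-colouring of a graph $G$ is a function $c:E(G)\to\{1,\dots,r\}$ (not necessarily proper). A path is rainbow if all its edges have distinct colours. For a $2$-connected graph $G$, a colouring is rainbow $2$-connected if every two vertices of $G$ are connected by two internally vertex-disjoint rainbow paths, and the rainbow $2$-connection number $rc_2(G)$ is the minimum number of colours in a rainbow $2$-connected colouring of $G$. For integers $n$ and $r\ge 1$, $t_2(n,r)$ denotes the minimum number of edges in a $2$-connected graph $G$ on $n$ vertices with $rc_2(G)\le r$. -}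

module Defs where

open import Data.Nat using (ℕ; _<ᵇ_; _≤_)
open import Data.Bool using (Bool; true; false; _∧_)
open import Data.Fin using (Fin; toℕ)
open import Data.List using (List; []; _∷_; _++_; length; map; filterᵇ; cartesianProduct; allFin; zip; drop)
open import Data.List.Relation.Unary.Unique.Propositional using (Unique)
open import Data.List.Relation.Unary.Linked using (Linked)
open import Data.List.Membership.Propositional using (_∈_; _∉_)
open import Data.Product using (Σ; Σ-syntax; _×_; _,_; proj₁; proj₂)
open import Data.Empty using (⊥)
open import Relation.Binary.PropositionalEquality using (_≡_; _≢_)

record Graph (n : ℕ) : Set where
  field
    adj   : Fin n → Fin n → Bool
    sym   : ∀ i j → adj i j ≡ adj j i
    irref : ∀ i → adj i i ≡ false
open Graph public

_~[_]_ : ∀ {n} → Fin n → Graph n → Fin n → Set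
i ~[ G ] j = adj G i j ≡ true

∣E∣ : ∀ {n} → Graph n → ℕ
∣E∣ {n} G = length (filterᵇ (λ p → (toℕ (proj₁ p) <ᵇ toℕ (proj₂ p)) ∧ adj G (proj₁ p) (proj₂ p))
                            (cartesianProduct (allFin n) (allFin n)))

pathSeq : ∀ {n} → Fin n → List (Fin n) → Fin n → List (Fin n)
pathSeq u xs v = u ∷ (xs ++ (v ∷ []))

steps : ∀ {A : Set} → List A → List (A × A)
steps xs = zip xs (drop 1 xs)

IsPath : ∀ {n} → Graph n → Fin n → List (Fin n) → Fin n → Set
IsPath G u xs v = Unique (pathSeq u xs v) × Linked (λ a b → a ~[ G ] b) (pathSeq u xs v)

TwoConnected : ∀ {n} → Graph n → Set
TwoConnected {n} G =
  3 ≤ n ×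
  (∀ (w u v : Fin n) → u ≢ w → v ≢ w → u ≢ v →
     Σ[ xs ∈ List (Fin n) ] (IsPath G u xs v × w ∉ xs))

-- An r-colouring of G: colours Fin r (standing for {1,…,r}); a colour for each edge,
-- represented by a function on pairs that is symmetric on edges (only values on edges matter).
record Colouring {n} (G : Graph n) (r : ℕ) : Set where
  field
    col    : Fin n → Fin n → Fin r
    colSym : ∀ i j → i ~[ G ] j → col i j ≡ col j i
open Colouring public

Rainbow : ∀ {n r} {G : Graph n} → Colouring G r → List (Fin n) → Set
Rainbow c vs = Unique (map (λ p → col c (proj₁ p) (proj₂ p)) (steps vs))

Rainbow2Connected : ∀ {n r} {G : Graph n} → Colouring G r → Set
Rainbow2Connected {n} {r} {G} c =
  ∀ (u v : Fin n) → u ≢ v →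
    Σ[ xs ∈ List (Fin n) ] Σ[ ys ∈ List (Fin n) ]
      ( IsPath G u xs v × Rainbow c (pathSeq u xs v)
      × IsPath G u ys v × Rainbow c (pathSeq u ys v)
      × xs ≢ ys
      × (∀ x → x ∈ xs → x ∈ ys → ⊥))

RC2AtMost : ∀ {n} → Graph n → ℕ → Set
RC2AtMost G r = Σ[ c ∈ Colouring G r ] Rainbow2Connected c

-- t₂(n,r) ≤ b, where the bound is given as a predicate B on the edge count:
-- some 2-connected graph G on n vertices with rc₂(G) ≤ r has |E(G)| satisfying B.
T2Bound : (n r : ℕ) → (ℕ → Set) → Set
T2Bound n r B = Σ[ G ∈ Graph n ] (TwoConnected G × RC2AtMost G r × B (∣E∣ G))

-- Every graph used is a hub graph: two hubs A and B, a core of q further vertices each joined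
-- to both hubs, g ≥ 1 disjoint copies of a small coloured gadget attached to the hubs, and, for
-- r ≥ 6, a path (the spine) of m = r − 5 new vertices from A to B whose end edges get colours
-- 0 (at A) and 1 (at B) and whose inner edges get fresh colours 5, 6, ….  Two vertices of the
-- core and one gadget copy are joined by two internally disjoint rainbow paths inside that
-- copy, two vertices of different copies inside the union of the two copies; these are
-- finitely many coloured graphs, checked by a decision procedure.  A spine vertex reaches A by
-- walking down the spine and B by walking up it, and continues inside one copy along paths
-- that avoid the fresh colours and colour 0 (from A) resp. colour 1 (from B), so the
-- concatenations stay rainbow and disjoint.  For r ∈ {3, 4} the gadget is an edge joined to
-- both hubs (2 vertices, 5 edges, q ≤ 1), for r ≥ 5 a 4-cycle whose two pairs of opposite
-- vertices are joined to A and to B respectively (4 vertices, 8 edges, q ≤ 3).  Writing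
-- n − 2 − m = q + s·g with s the gadget size, the graph has at most 2q + 5g resp.
-- 2q + 8g + m + 1 edges, which gives the three bounds.

module Submission where

open import Defs hiding (sym; adj; col)
open import Data.Nat using (ℕ; zero; suc; _+_; _*_; _∸_; _≤_; _<_; _<ᵇ_; _≡ᵇ_; _<?_; _⊓_; z≤n; s≤s; NonZero)
import Data.Nat as ℕ
open import Data.Nat.Properties hiding (_≟_)
open import Data.Nat.DivMod using (_/_; _%_; m≡m%n+[m/n]*n; m%n<n; m≥n⇒m/n>0)
open import Data.Nat.Tactic.RingSolver using (solve-∀)
open import Data.Bool using (Bool; true; false; T; T?; _∧_; _∨_; if_then_else_)
import Data.Bool as Bool
open import Data.Bool.Properties using (T-∧; T-≡; ∨-comm; ∨-identityʳ)
import Data.Fin as Fin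
open import Data.Fin using (Fin; toℕ; fromℕ<; #_; splitAt; _↑ˡ_; _↑ʳ_; combine; remQuot)
open import Data.Fin.Properties using (_≟_; all?; toℕ-injective; toℕ<n; toℕ-fromℕ<; fromℕ<-toℕ; splitAt-↑ˡ; splitAt-↑ʳ; splitAt⁻¹-↑ˡ; splitAt⁻¹-↑ʳ; join-splitAt; remQuot-combine; combine-remQuot)
open import Data.List using (List; []; _∷_; _++_; length; map; reverse; filterᵇ; cartesianProduct; allFin; upTo)
open import Data.List.Properties using (length-++; length-map; length-upTo; length-tabulate; map-++; ++-assoc; unfold-reverse; reverse-++; reverse-involutive; map-injective; ≡-dec)
open import Data.List.Relation.Unary.Unique.Propositional using (Unique; []; _∷_)
import Data.List.Relation.Unary.Unique.Propositional.Properties as Unique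
open import Data.List.Relation.Unary.Unique.DecPropositional using (unique?)
import Data.List.Relation.Unary.All as All
import Data.List.Relation.Unary.All.Properties as All
open import Data.List.Relation.Unary.Any using (here; there)
open import Data.List.Relation.Unary.Any.Properties using (reverse⁻)
open import Data.List.Relation.Unary.Linked using (Linked; []; [-]; _∷_; linked?)
open import Data.List.Relation.Binary.Disjoint.Propositional using (Disjoint)
open import Data.List.Relation.Binary.Disjoint.DecPropositional using (disjoint?)
open import Data.List.Relation.Binary.Subset.Propositional using (_⊆_)
open import Data.List.Membership.Propositional using (_∈_; _∉_)
open import Data.List.Membership.Propositional.Properties using (∈-∃++; ∈-++⁻; ∈-++⁺ˡ; ∈-++⁺ʳ; ∈-map⁺; ∈-map⁻; ∈-filter⁺; ∈-filter⁻; ∈-cartesianProduct⁺; ∈-allFin; ∈-upTo⁺)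
open import Data.List.Membership.DecPropositional using (_∈?_)
open import Data.Vec using (Vec; []; _∷_; lookup)
open import Data.Product using (Σ-syntax; _×_; _,_; proj₁; proj₂; swap; uncurry)
open import Data.Sum using (_⊎_; inj₁; inj₂)
open import Data.Empty using (⊥; ⊥-elim)
open import Data.Unit using (⊤; tt)
open import Function using (_∘_)
open import Function.Bundles using (Equivalence)
open import Relation.Nullary using (¬_; Dec; yes; no; ¬?)
open import Relation.Nullary.Decidable using (True; toWitness; recompute; _×-dec_; _⊎-dec_; map′)
open import Relation.Binary.Definitions using (tri<; tri≈; tri>)
open import Relation.Binary.PropositionalEquality using (_≡_; _≢_; refl; sym; trans; cong; cong₂; subst; subst₂; module ≡-Reasoning)

module _ {A : Set} where

  Unique-length-≤ : {xs ys : List A} → Unique xs → xs ⊆ ys → length xs ≤ length ys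
  Unique-length-≤ {[]} _ _ = z≤n
  Unique-length-≤ {x ∷ xs} (x∉xs ∷ xs!) xs⊆ys with ∈-∃++ (xs⊆ys (here refl))
  ... | ys₁ , ys₂ , refl = subst (suc (length xs) ≤_) length-split
          (s≤s (Unique-length-≤ xs! xs⊆ys₁ys₂))
    where
    length-split : suc (length (ys₁ ++ ys₂)) ≡ length (ys₁ ++ x ∷ ys₂)
    length-split = trans (cong suc (length-++ ys₁)) (trans (sym (+-suc _ _)) (sym (length-++ ys₁)))
    xs⊆ys₁ys₂ : xs ⊆ ys₁ ++ ys₂
    xs⊆ys₁ys₂ z∈xs with ∈-++⁻ ys₁ (xs⊆ys (there z∈xs))
    ... | inj₁ z∈ys₁ = ∈-++⁺ˡ z∈ys₁
    ... | inj₂ (here refl) = ⊥-elim (All.lookup x∉xs z∈xs refl)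
    ... | inj₂ (there z∈ys₂) = ∈-++⁺ʳ ys₁ z∈ys₂

  Unique-++⁻ˡ : (xs : List A) {ys : List A} → Unique (xs ++ ys) → Unique xs
  Unique-++⁻ˡ [] _ = []
  Unique-++⁻ˡ (x ∷ xs) (x∉ ∷ xs!) = All.++⁻ˡ xs x∉ ∷ Unique-++⁻ˡ xs xs!

  Unique-++⁻-disjoint : (xs : List A) {ys : List A} → Unique (xs ++ ys) → Disjoint xs ys
  Unique-++⁻-disjoint (x ∷ xs) (x∉ ∷ _) (here refl , z∈ys) = All.lookup (All.++⁻ʳ xs x∉) z∈ys refl
  Unique-++⁻-disjoint (x ∷ xs) (_ ∷ xs!) (there z∈xs , z∈ys) = Unique-++⁻-disjoint xs xs! (z∈xs , z∈ys)

  Unique-reverse : {xs : List A} → Unique xs → Unique (reverse xs)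
  Unique-reverse {[]} [] = []
  Unique-reverse {x ∷ xs} (x∉ ∷ xs!) = subst Unique (sym (unfold-reverse x xs))
    (Unique.++⁺ (Unique-reverse xs!) (All.[] ∷ []) λ { (z∈ , here refl) → All.lookup x∉ (reverse⁻ z∈) refl })

  reverse-≢ : {xs ys : List A} → xs ≢ ys → reverse xs ≢ reverse ys
  reverse-≢ {xs} {ys} xs≢ys eq =
    xs≢ys (trans (sym (reverse-involutive xs)) (trans (cong reverse eq) (reverse-involutive ys)))

  reverse-∷∷ : (x y : A) (xs : List A) → reverse (x ∷ y ∷ xs) ≡ reverse xs ++ y ∷ x ∷ []
  reverse-∷∷ x y xs = trans (unfold-reverse x (y ∷ xs))
    (trans (cong (_++ x ∷ []) (unfold-reverse y xs)) (++-assoc (reverse xs) (y ∷ []) (x ∷ [])))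

  module _ {R : A → A → Set} where

    Linked-join : (xs : List A) {w : A} {ys : List A} → Linked R (xs ++ w ∷ []) → Linked R (w ∷ ys) → Linked R (xs ++ w ∷ ys)
    Linked-join [] _ Rys = Rys
    Linked-join (x ∷ []) (Rxw ∷ _) Rys = Rxw ∷ Rys
    Linked-join (x ∷ y ∷ xs) (Rxy ∷ Rxs) Rys = Rxy ∷ Linked-join (y ∷ xs) Rxs Rys

    Linked-reverse : (∀ {x y} → R x y → R y x) → {xs : List A} → Linked R xs → Linked R (reverse xs)
    Linked-reverse R-sym {[]} [] = []
    Linked-reverse R-sym {x ∷ []} [-] = [-]
    Linked-reverse R-sym {x ∷ y ∷ xs} (Rxy ∷ Rys) = subst (Linked R) (sym (reverse-∷∷ x y xs))
      (Linked-join (reverse xs) (subst (Linked R) (unfold-reverse y xs) (Linked-reverse R-sym Rys)) (R-sym Rxy ∷ [-]))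

module RainbowPaths {V : Set} (adj : V → V → Bool) (col : V → V → ℕ) where

  Edge : V → V → Set
  Edge u v = adj u v ≡ true

  colours : List V → List ℕ
  colours (x ∷ y ∷ vs) = col x y ∷ colours (y ∷ vs)
  colours _ = []

  record RainbowPath (vs : List V) : Set where
    field
      distinct : Unique vs
      linked   : Linked Edge vs
      rainbow  : Unique (colours vs)
  open RainbowPath public

  via : V → List V → V → List V
  via u xs v = u ∷ xs ++ v ∷ []

  RainbowVia : V → List V → V → Set
  RainbowVia u xs v = RainbowPath (via u xs v)

  record RainbowPair (u v : V) : Set where
    field
      inner₁ inner₂ : List V
      path₁ : RainbowVia u inner₁ v
      path₂ : RainbowVia u inner₂ v
      inner₁≢inner₂ : inner₁ ≢ inner₂
      disjoint : Disjoint inner₁ inner₂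

  RainbowTwoConnected : Set
  RainbowTwoConnected = ∀ u v → u ≢ v → RainbowPair u v

  colours-++ : (xs : List V) (w : V) (ys : List V) → colours (xs ++ w ∷ ys) ≡ colours (xs ++ w ∷ []) ++ colours (w ∷ ys)
  colours-++ [] w ys = refl
  colours-++ (x ∷ []) w ys = refl
  colours-++ (x ∷ y ∷ xs) w ys = cong (col x y ∷_) (colours-++ (y ∷ xs) w ys)

  join : (xs : List V) (w : V) (ys : List V) → RainbowPath (xs ++ w ∷ []) → RainbowPath (w ∷ ys) →
         Disjoint xs ys → Disjoint (colours (xs ++ w ∷ [])) (colours (w ∷ ys)) → RainbowPath (xs ++ w ∷ ys)
  join xs w ys p q xs#ys cs#ds = record
    { distinct = Unique.++⁺ (Unique-++⁻ˡ xs (distinct p)) (distinct q) xs#wys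
    ; linked   = Linked-join xs (linked p) (linked q)
    ; rainbow  = subst Unique (sym (colours-++ xs w ys)) (Unique.++⁺ (rainbow p) (rainbow q) cs#ds)
    }
    where
    xs#wys : Disjoint xs (w ∷ ys)
    xs#wys (z∈xs , here refl) = Unique-++⁻-disjoint xs (distinct p) (z∈xs , here refl)
    xs#wys (z∈xs , there z∈ys) = xs#ys (z∈xs , z∈ys)

  via-++ : ∀ u xs w ys v → via u (xs ++ w ∷ ys) v ≡ (u ∷ xs) ++ w ∷ (ys ++ v ∷ [])
  via-++ u xs w ys v = cong (u ∷_) (++-assoc xs (w ∷ ys) (v ∷ []))

  join-via : ∀ {u w v} xs ys → RainbowVia u xs w → RainbowVia w ys v →
             Disjoint (u ∷ xs) (ys ++ v ∷ []) → Disjoint (colours (via u xs w)) (colours (via w ys v)) →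
             RainbowVia u (xs ++ w ∷ ys) v
  join-via {u} {w} {v} xs ys p q vs# cs# =
    subst RainbowPath (sym (via-++ u xs w ys v)) (join (u ∷ xs) w (ys ++ v ∷ []) p q vs# cs#)

  colours-via-++⁻ : ∀ {c} u xs w ys v → c ∈ colours (via u (xs ++ w ∷ ys) v) →
                    c ∈ colours (via u xs w) ⊎ c ∈ colours (via w ys v)
  colours-via-++⁻ {c} u xs w ys v c∈ = ∈-++⁻ (colours (via u xs w))
    (subst (c ∈_) (colours-++ (u ∷ xs) w (ys ++ v ∷ [])) (subst (λ vs → c ∈ colours vs) (via-++ u xs w ys v) c∈))

  module Symmetric (adj-sym : ∀ {x y} → Edge x y → Edge y x) (col-sym : ∀ {x y} → Edge x y → col x y ≡ col y x) where

    colours-reverse : {vs : List V} → Linked Edge vs → colours (reverse vs) ≡ reverse (colours vs)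
    colours-reverse {[]} _ = refl
    colours-reverse {x ∷ []} _ = refl
    colours-reverse {x ∷ y ∷ vs} (xy ∷ ys) = begin
      colours (reverse (x ∷ y ∷ vs))                   ≡⟨ cong colours (reverse-∷∷ x y vs) ⟩
      colours (reverse vs ++ y ∷ x ∷ [])               ≡⟨ colours-++ (reverse vs) y (x ∷ []) ⟩
      colours (reverse vs ++ y ∷ []) ++ col y x ∷ []   ≡⟨ cong₂ (λ ws c → colours ws ++ c ∷ []) (sym (unfold-reverse y vs)) (sym (col-sym xy)) ⟩
      colours (reverse (y ∷ vs)) ++ col x y ∷ []       ≡⟨ cong (_++ col x y ∷ []) (colours-reverse ys) ⟩
      reverse (colours (y ∷ vs)) ++ col x y ∷ []       ≡⟨ sym (unfold-reverse (col x y) (colours (y ∷ vs))) ⟩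
      reverse (colours (x ∷ y ∷ vs))                   ∎
      where open ≡-Reasoning

    ∈-colours-reverse⁻ : ∀ {c vs} → Linked Edge vs → c ∈ colours (reverse vs) → c ∈ colours vs
    ∈-colours-reverse⁻ {c} l c∈ = reverse⁻ (subst (c ∈_) (colours-reverse l) c∈)

    RainbowPath-reverse : {vs : List V} → RainbowPath vs → RainbowPath (reverse vs)
    RainbowPath-reverse p = record
      { distinct = Unique-reverse (distinct p)
      ; linked   = Linked-reverse adj-sym (linked p)
      ; rainbow  = subst Unique (sym (colours-reverse (linked p))) (Unique-reverse (rainbow p))
      }

    reverse-via : ∀ u xs v → reverse (via u xs v) ≡ via v (reverse xs) u
    reverse-via u xs v = trans (unfold-reverse u (xs ++ v ∷ [])) (cong (_++ u ∷ []) (reverse-++ xs (v ∷ [])))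

    reverse-path : ∀ {u xs v} → RainbowVia u xs v → RainbowVia v (reverse xs) u
    reverse-path {u} {xs} {v} = subst RainbowPath (reverse-via u xs v) ∘ RainbowPath-reverse

    ∈-colours-reverse-path⁻ : ∀ {c u xs v} → RainbowVia u xs v → c ∈ colours (via v (reverse xs) u) →
                              c ∈ colours (via u xs v)
    ∈-colours-reverse-path⁻ {c} {u} {xs} {v} p c∈ =
      ∈-colours-reverse⁻ (linked p) (subst (λ vs → c ∈ colours vs) (sym (reverse-via u xs v)) c∈)

    RainbowPair-sym : ∀ {u v} → RainbowPair u v → RainbowPair v u
    RainbowPair-sym P = record
      { inner₁ = reverse inner₁
      ; inner₂ = reverse inner₂
      ; path₁ = reverse-path path₁
      ; path₂ = reverse-path path₂
      ; inner₁≢inner₂ = reverse-≢ inner₁≢inner₂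
      ; disjoint = λ (z∈₁ , z∈₂) → disjoint (reverse⁻ z∈₁ , reverse⁻ z∈₂)
      }
      where open RainbowPair P

module Embedding {V W : Set} (adjV : V → V → Bool) (colV : V → V → ℕ) (adjW : W → W → Bool) (colW : W → W → ℕ)
                 (φ : V → W) (φ-injective : ∀ {x y} → φ x ≡ φ y → x ≡ y)
                 (φ-edge : ∀ {x y} → adjV x y ≡ true → adjW (φ x) (φ y) ≡ true)
                 (φ-col : ∀ {x y} → adjV x y ≡ true → colW (φ x) (φ y) ≡ colV x y) where

  private
    module S = RainbowPaths adjV colV
    module T = RainbowPaths adjW colW

  Linked-map : {vs : List V} → Linked S.Edge vs → Linked T.Edge (map φ vs)
  Linked-map [] = []
  Linked-map [-] = [-]
  Linked-map (e ∷ es) = φ-edge e ∷ Linked-map es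

  colours-map : {vs : List V} → Linked S.Edge vs → T.colours (map φ vs) ≡ S.colours vs
  colours-map [] = refl
  colours-map [-] = refl
  colours-map (e ∷ es) = cong₂ _∷_ (φ-col e) (colours-map es)

  via-map : ∀ u xs v → map φ (S.via u xs v) ≡ T.via (φ u) (map φ xs) (φ v)
  via-map u xs v = cong (φ u ∷_) (map-++ φ xs (v ∷ []))

  map-path : ∀ {u xs v} → S.RainbowVia u xs v → T.RainbowVia (φ u) (map φ xs) (φ v)
  map-path {u} {xs} {v} p = subst T.RainbowPath (via-map u xs v) record
    { distinct = Unique.map⁺ φ-injective (S.distinct p)
    ; linked   = Linked-map (S.linked p)
    ; rainbow  = subst Unique (sym (colours-map (S.linked p))) (S.rainbow p)
    }

  ∈-colours-map-path⁻ : ∀ {c u xs v} → S.RainbowVia u xs v →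
                        c ∈ T.colours (T.via (φ u) (map φ xs) (φ v)) → c ∈ S.colours (S.via u xs v)
  ∈-colours-map-path⁻ {c} {u} {xs} {v} p c∈ =
    subst (c ∈_) (colours-map (S.linked p)) (subst (λ ws → c ∈ T.colours ws) (sym (via-map u xs v)) c∈)

  ∈-map-injective : ∀ {z xs} → φ z ∈ map φ xs → z ∈ xs
  ∈-map-injective {z} {xs} φz∈ with ∈-map⁻ φ φz∈
  ... | x , x∈xs , eq = subst (_∈ xs) (sym (φ-injective eq)) x∈xs

  map-pair : ∀ {u v} → S.RainbowPair u v → T.RainbowPair (φ u) (φ v)
  map-pair P = record
    { inner₁ = map φ inner₁
    ; inner₂ = map φ inner₂
    ; path₁ = map-path path₁
    ; path₂ = map-path path₂
    ; inner₁≢inner₂ = λ eq → inner₁≢inner₂ (map-injective φ-injective eq)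
    ; disjoint = disjoint-map
    }
    where
    open S.RainbowPair P
    disjoint-map : Disjoint (map φ inner₁) (map φ inner₂)
    disjoint-map (z∈₁ , z∈₂) with ∈-map⁻ φ z∈₁
    ... | x , x∈₁ , refl = disjoint (x∈₁ , ∈-map-injective z∈₂)

module Realisation {V : Set} (n r : ℕ) (to : V → Fin n) (from : Fin n → V)
  (from∘to : ∀ v → from (to v) ≡ v) (to∘from : ∀ i → to (from i) ≡ i)
  (adjV : V → V → Bool) (adjV-sym : ∀ u v → adjV u v ≡ adjV v u) (adjV-irrefl : ∀ u → adjV u u ≡ false)
  (colV : V → V → ℕ) (colV-sym : ∀ u v → adjV u v ≡ true → colV u v ≡ colV v u)
  (colV-< : ∀ u v → colV u v < r) where

  open RainbowPaths

  graph : Graph n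
  graph = record
    { adj = λ i j → adjV (from i) (from j)
    ; sym = λ i j → adjV-sym (from i) (from j)
    ; irref = λ i → adjV-irrefl (from i)
    }

  fromℕ<-cong : ∀ {a b} .(a<r : a < r) .(b<r : b < r) → a ≡ b → fromℕ< a<r ≡ fromℕ< b<r
  fromℕ<-cong _ _ refl = refl

  colouring : Colouring graph r
  colouring = record
    { col = λ i j → fromℕ< (colV-< (from i) (from j))
    ; colSym = λ i j e → fromℕ<-cong _ _ (colV-sym (from i) (from j) e)
    }

  adjF : Fin n → Fin n → Bool
  adjF = Graph.adj graph

  colF : Fin n → Fin n → ℕ
  colF i j = toℕ (Colouring.col colouring i j)

  from-injective : ∀ {i j} → from i ≡ from j → i ≡ j
  from-injective {i} {j} eq = trans (sym (to∘from i)) (trans (cong to eq) (to∘from j))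

  to-injective : ∀ {u v} → to u ≡ to v → u ≡ v
  to-injective {u} {v} eq = trans (sym (from∘to u)) (trans (cong from eq) (from∘to v))

  to-edge : ∀ {x y} → adjV x y ≡ true → adjF (to x) (to y) ≡ true
  to-edge {x} {y} = subst (_≡ true) (sym (cong₂ adjV (from∘to x) (from∘to y)))

  to-col : ∀ {x y} → adjV x y ≡ true → colF (to x) (to y) ≡ colV x y
  to-col {x} {y} _ = trans (toℕ-fromℕ< (colV-< (from (to x)) (from (to y)))) (cong₂ colV (from∘to x) (from∘to y))

  module ToFin = Embedding adjV colV adjF colF to to-injective to-edge to-col

  colours-steps : (vs : List (Fin n)) →
    map toℕ (map (λ p → Colouring.col colouring (proj₁ p) (proj₂ p)) (steps vs)) ≡ colours adjF colF vs
  colours-steps [] = refl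
  colours-steps (x ∷ []) = refl
  colours-steps (x ∷ y ∷ vs) = cong (colF x y ∷_) (colours-steps (y ∷ vs))

  module _ (rainbow-2-connected : RainbowTwoConnected adjV colV) where

    pairF : ∀ i j → i ≢ j → RainbowPair adjF colF i j
    pairF i j i≢j = subst₂ (RainbowPair adjF colF) (to∘from i) (to∘from j)
      (ToFin.map-pair (rainbow-2-connected (from i) (from j) (λ eq → i≢j (from-injective eq))))

    isPath : ∀ {u xs v} → RainbowPath adjF colF (via adjF colF u xs v) → IsPath graph u xs v
    isPath p = distinct p , linked p

    isRainbow : ∀ {u xs v} → RainbowPath adjF colF (via adjF colF u xs v) → Rainbow colouring (pathSeq u xs v)
    isRainbow {u} {xs} {v} p = Unique.map⁻ (subst Unique (sym (colours-steps (pathSeq u xs v))) (rainbow p))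

    rainbow2Connected : Rainbow2Connected colouring
    rainbow2Connected u v u≢v = inner₁ , inner₂ , isPath path₁ , isRainbow path₁ , isPath path₂ , isRainbow path₂ ,
      inner₁≢inner₂ , λ z z∈₁ z∈₂ → disjoint (z∈₁ , z∈₂)
      where open RainbowPair (pairF u v u≢v)

    twoConnected : 3 ≤ n → TwoConnected graph
    twoConnected 3≤n = 3≤n , avoiding
      where
      avoiding : ∀ w u v → u ≢ w → v ≢ w → u ≢ v → Σ[ xs ∈ List (Fin n) ] (IsPath graph u xs v × w ∉ xs)
      avoiding w u v _ _ u≢v with pairF u v u≢v
      ... | P with _∈?_ _≟_ w (RainbowPair.inner₁ P)
      ... | no w∉ = RainbowPair.inner₁ P , isPath (RainbowPair.path₁ P) , w∉
      ... | yes w∈ = RainbowPair.inner₂ P , isPath (RainbowPair.path₂ P) , λ w∈₂ → RainbowPair.disjoint P (w∈ , w∈₂)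

  module _ (S : List (V × V)) (S-complete : ∀ u v → adjV u v ≡ true → (u , v) ∈ S) where

    IsEdgeUp : Fin n × Fin n → Bool
    IsEdgeUp (i , j) = (toℕ i <ᵇ toℕ j) ∧ adjF i j

    edgesUp : List (Fin n × Fin n)
    edgesUp = filterᵇ IsEdgeUp (cartesianProduct (allFin n) (allFin n))

    ∈-edgesUp⁻ : ∀ {i j} → (i , j) ∈ edgesUp → toℕ i < toℕ j × adjF i j ≡ true
    ∈-edgesUp⁻ {i} {j} p with Equivalence.to T-∧ (proj₂ (∈-filter⁻ (λ q → T? (IsEdgeUp q)) {xs = cartesianProduct (allFin n) (allFin n)} p))
    ... | i<j , e = <ᵇ⇒< (toℕ i) (toℕ j) i<j , Equivalence.to T-≡ e

    edgesUp-unique : Unique edgesUp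
    edgesUp-unique = Unique.filter⁺ (λ p → T? (IsEdgeUp p)) (Unique.cartesianProduct⁺ (Unique.allFin⁺ n) (Unique.allFin⁺ n))

    swap-injective : ∀ {p q : Fin n × Fin n} → swap p ≡ swap q → p ≡ q
    swap-injective {_ , _} {_ , _} refl = refl

    directedEdges : List (Fin n × Fin n)
    directedEdges = edgesUp ++ map swap edgesUp

    directedEdges-unique : Unique directedEdges
    directedEdges-unique = Unique.++⁺ edgesUp-unique (Unique.map⁺ swap-injective edgesUp-unique) up#down
      where
      up#down : Disjoint edgesUp (map swap edgesUp)
      up#down {i , j} (up , down) with ∈-map⁻ swap down
      ... | (_ , _) , down′ , refl = <-asym (proj₁ (∈-edgesUp⁻ up)) (proj₁ (∈-edgesUp⁻ down′))

    fromPair : Fin n × Fin n → V × V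
    fromPair (i , j) = from i , from j

    fromPair-injective : ∀ {p q} → fromPair p ≡ fromPair q → p ≡ q
    fromPair-injective eq = cong₂ _,_ (from-injective (cong proj₁ eq)) (from-injective (cong proj₂ eq))

    fromPair-⊆ : ∀ {e} → e ∈ map fromPair directedEdges → e ∈ S
    fromPair-⊆ e∈ with ∈-map⁻ fromPair e∈
    ... | (i , j) , p , refl with ∈-++⁻ edgesUp p
    ... | inj₁ up = S-complete _ _ (proj₂ (∈-edgesUp⁻ up))
    ... | inj₂ down with ∈-map⁻ swap down
    ... | _ , down′ , refl = S-complete _ _ (trans (adjV-sym (from i) (from j)) (proj₂ (∈-edgesUp⁻ down′)))

    double-∣E∣≤ : 2 * ∣E∣ graph ≤ length S
    double-∣E∣≤ = subst (_≤ length S) length-directed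
      (Unique-length-≤ (Unique.map⁺ fromPair-injective directedEdges-unique) fromPair-⊆)
      where
      length-directed : length (map fromPair directedEdges) ≡ 2 * ∣E∣ graph
      length-directed = trans (length-map fromPair directedEdges) (trans (length-++ edgesUp)
        (cong (length edgesUp +_) (trans (length-map swap edgesUp) (sym (+-identityʳ _)))))

≡ᵇ-refl : ∀ k → (k ≡ᵇ k) ≡ true
≡ᵇ-refl zero = refl
≡ᵇ-refl (suc k) = ≡ᵇ-refl k

≡ᵇ-sym : ∀ a b → (a ≡ᵇ b) ≡ (b ≡ᵇ a)
≡ᵇ-sym zero zero = refl
≡ᵇ-sym zero (suc b) = refl
≡ᵇ-sym (suc a) zero = refl
≡ᵇ-sym (suc a) (suc b) = ≡ᵇ-sym a b

suc≡ᵇ-false : ∀ j → (suc j ≡ᵇ j) ≡ false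
suc≡ᵇ-false zero = refl
suc≡ᵇ-false (suc j) = suc≡ᵇ-false j

≡ᵇ-true⇒≡ : ∀ a b → (a ≡ᵇ b) ≡ true → a ≡ b
≡ᵇ-true⇒≡ a b e = ≡ᵇ⇒≡ a b (Equivalence.from T-≡ e)

≢⇒≡ᵇ-false : ∀ x y → x ≢ y → (x ≡ᵇ y) ≡ false
≢⇒≡ᵇ-false x y x≢y with x ≡ᵇ y in eq
... | true = ⊥-elim (x≢y (≡ᵇ-true⇒≡ x y eq))
... | false = refl

-- The hubs are the core vertices A = 0 and B = 1.
record Template : Set where
  field
    extra size : ℕ
    coreAdj   : Fin (2 + extra) → Fin (2 + extra) → Bool
    coreCol   : Fin (2 + extra) → Fin (2 + extra) → ℕ
    attachAdj : Fin (2 + extra) → Fin size → Bool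
    attachCol : Fin (2 + extra) → Fin size → ℕ
    gadgetAdj : Fin size → Fin size → Bool
    gadgetCol : Fin size → Fin size → ℕ

  c s : ℕ
  c = 2 + extra
  s = size

record WellFormed (T : Template) (k : ℕ) : Set where
  open Template T
  field
    size-positive  : 0 < size
    coreAdj-sym    : ∀ a b → coreAdj a b ≡ coreAdj b a
    coreAdj-irrefl : ∀ a → coreAdj a a ≡ false
    gadgetAdj-sym    : ∀ t u → gadgetAdj t u ≡ gadgetAdj u t
    gadgetAdj-irrefl : ∀ t → gadgetAdj t t ≡ false
    coreCol-sym   : ∀ a b → coreCol a b ≡ coreCol b a
    gadgetCol-sym : ∀ t u → gadgetCol t u ≡ gadgetCol u t
    coreCol-<   : ∀ a b → coreCol a b < k
    attachCol-< : ∀ a t → attachCol a t < k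
    gadgetCol-< : ∀ t u → gadgetCol t u < k

module Local (T : Template) where
  open Template T

  adj₁ : Fin c ⊎ Fin s → Fin c ⊎ Fin s → Bool
  adj₁ (inj₁ a) (inj₁ b) = coreAdj a b
  adj₁ (inj₁ a) (inj₂ t) = attachAdj a t
  adj₁ (inj₂ t) (inj₁ a) = attachAdj a t
  adj₁ (inj₂ t) (inj₂ u) = gadgetAdj t u

  col₁ : Fin c ⊎ Fin s → Fin c ⊎ Fin s → ℕ
  col₁ (inj₁ a) (inj₁ b) = coreCol a b
  col₁ (inj₁ a) (inj₂ t) = attachCol a t
  col₁ (inj₂ t) (inj₁ a) = attachCol a t
  col₁ (inj₂ t) (inj₂ u) = gadgetCol t u

  oneAdj : Fin (c + s) → Fin (c + s) → Bool
  oneAdj x y = adj₁ (splitAt c x) (splitAt c y)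

  oneCol : Fin (c + s) → Fin (c + s) → ℕ
  oneCol x y = col₁ (splitAt c x) (splitAt c y)

  copyOf : Fin s ⊎ Fin s → Fin s
  copyOf (inj₁ t) = t
  copyOf (inj₂ t) = t

  adj₂ : Fin c ⊎ (Fin s ⊎ Fin s) → Fin c ⊎ (Fin s ⊎ Fin s) → Bool
  adj₂ (inj₁ a) (inj₁ b) = coreAdj a b
  adj₂ (inj₁ a) (inj₂ y) = attachAdj a (copyOf y)
  adj₂ (inj₂ y) (inj₁ a) = attachAdj a (copyOf y)
  adj₂ (inj₂ (inj₁ t)) (inj₂ (inj₁ u)) = gadgetAdj t u
  adj₂ (inj₂ (inj₂ t)) (inj₂ (inj₂ u)) = gadgetAdj t u
  adj₂ (inj₂ (inj₁ t)) (inj₂ (inj₂ u)) = false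
  adj₂ (inj₂ (inj₂ t)) (inj₂ (inj₁ u)) = false

  col₂ : Fin c ⊎ (Fin s ⊎ Fin s) → Fin c ⊎ (Fin s ⊎ Fin s) → ℕ
  col₂ (inj₁ a) (inj₁ b) = coreCol a b
  col₂ (inj₁ a) (inj₂ y) = attachCol a (copyOf y)
  col₂ (inj₂ y) (inj₁ a) = attachCol a (copyOf y)
  col₂ (inj₂ y) (inj₂ y′) = gadgetCol (copyOf y) (copyOf y′)

  split₂ : Fin (c + (s + s)) → Fin c ⊎ (Fin s ⊎ Fin s)
  split₂ x with splitAt c x
  ... | inj₁ a = inj₁ a
  ... | inj₂ y = inj₂ (splitAt s y)

  twoAdj : Fin (c + (s + s)) → Fin (c + (s + s)) → Bool
  twoAdj x y = adj₂ (split₂ x) (split₂ y)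

  twoCol : Fin (c + (s + s)) → Fin (c + (s + s)) → ℕ
  twoCol x y = col₂ (split₂ x) (split₂ y)

  hubA hubB : Fin (c + s)
  hubA = Fin.zero
  hubB = Fin.suc Fin.zero

module LocalConditions (T : Template) (cf cl base : ℕ) where
  open Template T
  open Local T
  open RainbowPaths oneAdj oneCol

  record ToHubs (y : Fin (c + s)) : Set where
    field
      toA toB : List (Fin (c + s))
      toA-rainbow : RainbowVia y toA hubA
      toB-rainbow : RainbowVia y toB hubB
      hubB∉toA : hubB ∉ toA
      hubA∉toB : hubA ∉ toB
      toA#toB : Disjoint toA toB
      toA-colours : ∀ {x} → x ∈ colours (via y toA hubA) → x < base × x ≢ cf
      toB-colours : ∀ {x} → x ∈ colours (via y toB hubB) → x < base × x ≢ cl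

  record SpineCompatible : Set where
    field
      cf<base : cf < base
      cl<base : cl < base
      cf≢cl   : cf ≢ cl
      route   : List (Fin (c + s))
      route-rainbow : RainbowVia hubA route hubB
      route-colours : ∀ {x} → x ∈ colours (via hubA route hubB) → x < base × x ≢ cf × x ≢ cl
      toHubs  : ∀ y → y ≢ hubA → y ≢ hubB → ToHubs y

record LocalRainbow (T : Template) : Set where
  open Template T
  open Local T
  field
    oneCopy   : RainbowPaths.RainbowTwoConnected oneAdj oneCol
    twoCopies : ∀ t t′ → RainbowPaths.RainbowPair twoAdj twoCol (c ↑ʳ (t ↑ˡ s)) (c ↑ʳ (s ↑ʳ t′))

module HubGraph (T : Template) (cf cl base g′ m : ℕ) where
  open Template T
  open Local T

  g : ℕ
  g = suc g′

  -- A – path 0 – ⋯ – path (m − 1) – B is the spine; the bound j < m is irrelevant, so that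
  -- path j is determined by j.
  data Vertex : Set where
    core   : Fin c → Vertex
    gadget : Fin g → Fin s → Vertex
    path   : (j : ℕ) → .(j < m) → Vertex

  A B : Vertex
  A = core Fin.zero
  B = core (Fin.suc Fin.zero)

  recompute< : ∀ {j} → .(j < m) → j < m
  recompute< {j} j<m = recompute (j <? m) j<m

  positive : ∀ {j} → .(j < m) → 0 < m
  positive j<m = ≤-trans (s≤s z≤n) (recompute< j<m)

  path-cong : ∀ {j j′} .{p : j < m} .{q : j′ < m} → j ≡ j′ → path j p ≡ path j′ q
  path-cong refl = refl

  isA isB : Fin c → Bool
  isA a = toℕ a ≡ᵇ 0
  isB a = toℕ a ≡ᵇ 1

  hubPathAdj : Fin c → ℕ → Bool
  hubPathAdj a j = (isA a ∧ (j ≡ᵇ 0)) ∨ (isB a ∧ (suc j ≡ᵇ m))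

  hubPathCol : Fin c → ℕ
  hubPathCol a = if isA a then cf else cl

  adj : Vertex → Vertex → Bool
  adj (core a) (core b) = coreAdj a b
  adj (core a) (gadget i t) = attachAdj a t
  adj (core a) (path j _) = hubPathAdj a j
  adj (gadget i t) (core a) = attachAdj a t
  adj (gadget i t) (gadget i′ t′) = (toℕ i ≡ᵇ toℕ i′) ∧ gadgetAdj t t′
  adj (gadget _ _) (path _ _) = false
  adj (path j _) (core a) = hubPathAdj a j
  adj (path _ _) (gadget _ _) = false
  adj (path j _) (path j′ _) = (suc j ≡ᵇ j′) ∨ (suc j′ ≡ᵇ j)

  col : Vertex → Vertex → ℕ
  col (core a) (core b) = coreCol a b
  col (core a) (gadget i t) = attachCol a t
  col (core a) (path j _) = hubPathCol a
  col (gadget i t) (core a) = attachCol a t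
  col (gadget i t) (gadget i′ t′) = gadgetCol t t′
  col (gadget _ _) (path _ _) = 0
  col (path j _) (core a) = hubPathCol a
  col (path _ _) (gadget _ _) = 0
  col (path j _) (path j′ _) = base + (j ⊓ j′)

  n : ℕ
  n = c + (g * s + m)

  to : Vertex → Fin n
  to (core a) = a ↑ˡ (g * s + m)
  to (gadget i t) = c ↑ʳ (combine i t ↑ˡ m)
  to (path j p) = c ↑ʳ ((g * s) ↑ʳ fromℕ< p)

  fromGadgetOrPath : Fin (g * s) ⊎ Fin m → Vertex
  fromGadgetOrPath (inj₁ z) = uncurry gadget (remQuot s z)
  fromGadgetOrPath (inj₂ w) = path (toℕ w) (toℕ<n w)

  fromSplit : Fin c ⊎ Fin (g * s + m) → Vertex
  fromSplit (inj₁ a) = core a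
  fromSplit (inj₂ y) = fromGadgetOrPath (splitAt (g * s) y)

  from : Fin n → Vertex
  from x = fromSplit (splitAt c x)

  from∘to : ∀ v → from (to v) ≡ v
  from∘to (core a) rewrite splitAt-↑ˡ c a (g * s + m) = refl
  from∘to (gadget i t) rewrite splitAt-↑ʳ c (g * s + m) (combine i t ↑ˡ m)
                             | splitAt-↑ˡ (g * s) (combine i t) m = cong (uncurry gadget) (remQuot-combine i t)
  from∘to (path j p) rewrite splitAt-↑ʳ c (g * s + m) ((g * s) ↑ʳ fromℕ< p)
                           | splitAt-↑ʳ (g * s) m (fromℕ< p) = path-cong (toℕ-fromℕ< p)

  to∘fromGadgetOrPath : ∀ (y : Fin (g * s + m)) → to (fromGadgetOrPath (splitAt (g * s) y)) ≡ c ↑ʳ y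
  to∘fromGadgetOrPath y with splitAt (g * s) y in eq
  ... | inj₁ z = cong (c ↑ʳ_) (trans (cong (_↑ˡ m) (combine-remQuot {g} s z)) (splitAt⁻¹-↑ˡ eq))
  ... | inj₂ w = cong (c ↑ʳ_) (trans (cong ((g * s) ↑ʳ_) (fromℕ<-toℕ w (toℕ<n w))) (splitAt⁻¹-↑ʳ eq))

  to∘from : ∀ x → to (from x) ≡ x
  to∘from x with splitAt c x in eq
  ... | inj₁ a = splitAt⁻¹-↑ˡ eq
  ... | inj₂ y = trans (to∘fromGadgetOrPath y) (splitAt⁻¹-↑ʳ eq)

  IsPathVertex : Vertex → Set
  IsPathVertex (path _ _) = ⊤
  IsPathVertex _ = ⊥

  onCopy : Fin g → Fin c ⊎ Fin s → Vertex
  onCopy i (inj₁ a) = core a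
  onCopy i (inj₂ t) = gadget i t

  intoCopy : Fin g → Fin (c + s) → Vertex
  intoCopy i x = onCopy i (splitAt c x)

  intoCopy-not-path : ∀ i x → ¬ IsPathVertex (intoCopy i x)
  intoCopy-not-path i x with splitAt c x
  ... | inj₁ _ = λ ()
  ... | inj₂ _ = λ ()

  intoCopy-core : ∀ i a → intoCopy i (a ↑ˡ s) ≡ core a
  intoCopy-core i a rewrite splitAt-↑ˡ c a s = refl

  intoCopy-gadget : ∀ i t → intoCopy i (c ↑ʳ t) ≡ gadget i t
  intoCopy-gadget i t rewrite splitAt-↑ʳ c s t = refl

  onCopies : Fin g → Fin g → Fin c ⊎ (Fin s ⊎ Fin s) → Vertex
  onCopies i j (inj₁ a) = core a
  onCopies i j (inj₂ (inj₁ t)) = gadget i t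
  onCopies i j (inj₂ (inj₂ t)) = gadget j t

  intoCopies : Fin g → Fin g → Fin (c + (s + s)) → Vertex
  intoCopies i j x = onCopies i j (split₂ x)

  intoCopies-left : ∀ i j t → intoCopies i j (c ↑ʳ (t ↑ˡ s)) ≡ gadget i t
  intoCopies-left i j t rewrite splitAt-↑ʳ c (s + s) (t ↑ˡ s) | splitAt-↑ˡ s t s = refl

  intoCopies-right : ∀ i j t → intoCopies i j (c ↑ʳ (s ↑ʳ t)) ≡ gadget j t
  intoCopies-right i j t rewrite splitAt-↑ʳ c (s + s) (s ↑ʳ t) | splitAt-↑ʳ s s t = refl

  splitAt-injective : ∀ a b {x y : Fin (a + b)} → splitAt a x ≡ splitAt a y → x ≡ y
  splitAt-injective a b {x} {y} eq = trans (sym (join-splitAt a b x)) (trans (cong (Fin.join a b) eq) (join-splitAt a b y))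

  onCopy-injective : ∀ i {p q} → onCopy i p ≡ onCopy i q → p ≡ q
  onCopy-injective i {inj₁ a} {inj₁ .a} refl = refl
  onCopy-injective i {inj₂ t} {inj₂ .t} refl = refl

  intoCopy-injective : ∀ i {x y} → intoCopy i x ≡ intoCopy i y → x ≡ y
  intoCopy-injective i eq = splitAt-injective c s (onCopy-injective i eq)

  onCopy-edge : ∀ i {p q} → adj₁ p q ≡ true → adj (onCopy i p) (onCopy i q) ≡ true
  onCopy-edge i {inj₁ a} {inj₁ b} e = e
  onCopy-edge i {inj₁ a} {inj₂ t} e = e
  onCopy-edge i {inj₂ t} {inj₁ a} e = e
  onCopy-edge i {inj₂ t} {inj₂ t′} e rewrite ≡ᵇ-refl (toℕ i) = e

  onCopy-col : ∀ i {p q} → adj₁ p q ≡ true → col (onCopy i p) (onCopy i q) ≡ col₁ p q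
  onCopy-col i {inj₁ a} {inj₁ b} e = refl
  onCopy-col i {inj₁ a} {inj₂ t} e = refl
  onCopy-col i {inj₂ t} {inj₁ a} e = refl
  onCopy-col i {inj₂ t} {inj₂ t′} e = refl

  split₂-injective : ∀ {x y} → split₂ x ≡ split₂ y → x ≡ y
  split₂-injective {x} {y} eq with splitAt c x in ex | splitAt c y in ey
  split₂-injective {x} {y} refl | inj₁ a | inj₁ .a = splitAt-injective c (s + s) (trans ex (sym ey))
  split₂-injective {x} {y} eq | inj₂ u | inj₂ w =
    splitAt-injective c (s + s) (trans ex (trans (cong inj₂ (splitAt-injective s s (inj₂-injective eq))) (sym ey)))
    where
    inj₂-injective : ∀ {a b : Fin s ⊎ Fin s} → _≡_ {A = Fin c ⊎ (Fin s ⊎ Fin s)} (inj₂ a) (inj₂ b) → a ≡ b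
    inj₂-injective refl = refl

  onCopies-injective : ∀ {i j} → i ≢ j → ∀ {p q} → onCopies i j p ≡ onCopies i j q → p ≡ q
  onCopies-injective i≢j {inj₁ a} {inj₁ .a} refl = refl
  onCopies-injective i≢j {inj₂ (inj₁ t)} {inj₂ (inj₁ .t)} refl = refl
  onCopies-injective i≢j {inj₂ (inj₂ t)} {inj₂ (inj₂ .t)} refl = refl
  onCopies-injective i≢j {inj₂ (inj₁ t)} {inj₂ (inj₂ t′)} refl = ⊥-elim (i≢j refl)
  onCopies-injective i≢j {inj₂ (inj₂ t)} {inj₂ (inj₁ t′)} refl = ⊥-elim (i≢j refl)
  onCopies-injective i≢j {inj₁ a} {inj₂ (inj₁ t)} ()
  onCopies-injective i≢j {inj₁ a} {inj₂ (inj₂ t)} ()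
  onCopies-injective i≢j {inj₂ (inj₁ t)} {inj₁ a} ()
  onCopies-injective i≢j {inj₂ (inj₂ t)} {inj₁ a} ()

  intoCopies-injective : ∀ {i j} → i ≢ j → ∀ {x y} → intoCopies i j x ≡ intoCopies i j y → x ≡ y
  intoCopies-injective i≢j eq = split₂-injective (onCopies-injective i≢j eq)

  onCopies-edge : ∀ i j {p q} → adj₂ p q ≡ true → adj (onCopies i j p) (onCopies i j q) ≡ true
  onCopies-edge i j {inj₁ a} {inj₁ b} e = e
  onCopies-edge i j {inj₁ a} {inj₂ (inj₁ t)} e = e
  onCopies-edge i j {inj₁ a} {inj₂ (inj₂ t)} e = e
  onCopies-edge i j {inj₂ (inj₁ t)} {inj₁ a} e = e
  onCopies-edge i j {inj₂ (inj₂ t)} {inj₁ a} e = e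
  onCopies-edge i j {inj₂ (inj₁ t)} {inj₂ (inj₁ t′)} e rewrite ≡ᵇ-refl (toℕ i) = e
  onCopies-edge i j {inj₂ (inj₂ t)} {inj₂ (inj₂ t′)} e rewrite ≡ᵇ-refl (toℕ j) = e

  onCopies-col : ∀ i j {p q} → adj₂ p q ≡ true → col (onCopies i j p) (onCopies i j q) ≡ col₂ p q
  onCopies-col i j {inj₁ a} {inj₁ b} e = refl
  onCopies-col i j {inj₁ a} {inj₂ (inj₁ t)} e = refl
  onCopies-col i j {inj₁ a} {inj₂ (inj₂ t)} e = refl
  onCopies-col i j {inj₂ (inj₁ t)} {inj₁ a} e = refl
  onCopies-col i j {inj₂ (inj₂ t)} {inj₁ a} e = refl
  onCopies-col i j {inj₂ (inj₁ t)} {inj₂ (inj₁ t′)} e = refl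
  onCopies-col i j {inj₂ (inj₂ t)} {inj₂ (inj₂ t′)} e = refl

  module Copy (i : Fin g) = Embedding oneAdj oneCol adj col (intoCopy i) (intoCopy-injective i)
    (λ {x} {y} → onCopy-edge i {splitAt c x} {splitAt c y}) (λ {x} {y} → onCopy-col i {splitAt c x} {splitAt c y})

  module Copies (i j : Fin g) (i≢j : i ≢ j) = Embedding twoAdj twoCol adj col (intoCopies i j) (intoCopies-injective i≢j)
    (λ {x} {y} → onCopies-edge i j {split₂ x} {split₂ y}) (λ {x} {y} → onCopies-col i j {split₂ x} {split₂ y})

  module Properties {k : ℕ} (P : WellFormed T k) where
    open WellFormed P

    adj-sym : ∀ u v → adj u v ≡ adj v u
    adj-sym (core a) (core b) = coreAdj-sym a b
    adj-sym (core a) (gadget i t) = refl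
    adj-sym (core a) (path j _) = refl
    adj-sym (gadget i t) (core a) = refl
    adj-sym (gadget i t) (gadget i′ t′) = cong₂ _∧_ (≡ᵇ-sym (toℕ i) (toℕ i′)) (gadgetAdj-sym t t′)
    adj-sym (gadget _ _) (path _ _) = refl
    adj-sym (path j _) (core a) = refl
    adj-sym (path _ _) (gadget _ _) = refl
    adj-sym (path j _) (path j′ _) = ∨-comm (suc j ≡ᵇ j′) (suc j′ ≡ᵇ j)

    adj-irrefl : ∀ u → adj u u ≡ false
    adj-irrefl (core a) = coreAdj-irrefl a
    adj-irrefl (gadget i t) = trans (cong (_∧ gadgetAdj t t) (≡ᵇ-refl (toℕ i))) (gadgetAdj-irrefl t)
    adj-irrefl (path j _) = cong₂ _∨_ (suc≡ᵇ-false j) (suc≡ᵇ-false j)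

    col-sym : ∀ u v → adj u v ≡ true → col u v ≡ col v u
    col-sym (core a) (core b) _ = coreCol-sym a b
    col-sym (core a) (gadget i t) _ = refl
    col-sym (core a) (path j _) _ = refl
    col-sym (gadget i t) (core a) _ = refl
    col-sym (gadget i t) (gadget i′ t′) _ = gadgetCol-sym t t′
    col-sym (gadget _ _) (path _ _) _ = refl
    col-sym (path j _) (core a) _ = refl
    col-sym (path _ _) (gadget _ _) _ = refl
    col-sym (path j _) (path j′ _) _ = cong (base +_) (⊓-comm j j′)

    module _ {r : ℕ} (k≤r : k ≤ r) (cf<r : cf < r) (cl<r : cl < r) (base+m≤r : base + m ≤ r) where

      hubPathCol-< : ∀ a → hubPathCol a < r
      hubPathCol-< a with isA a
      ... | true = cf<r
      ... | false = cl<r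

      0<r : ∀ {j} → .(j < m) → 0 < r
      0<r j<m = ≤-trans (s≤s z≤n) (≤-trans (recompute< j<m) (≤-trans (m≤n+m m base) base+m≤r))

      col-< : ∀ u v → col u v < r
      col-< (core a) (core b) = ≤-trans (coreCol-< a b) k≤r
      col-< (core a) (gadget i t) = ≤-trans (attachCol-< a t) k≤r
      col-< (core a) (path j _) = hubPathCol-< a
      col-< (gadget i t) (core a) = ≤-trans (attachCol-< a t) k≤r
      col-< (gadget i t) (gadget i′ t′) = ≤-trans (gadgetCol-< t t′) k≤r
      col-< (gadget _ _) (path _ j<m) = 0<r j<m
      col-< (path j _) (core a) = hubPathCol-< a
      col-< (path _ j<m) (gadget _ _) = 0<r j<m
      col-< (path j j<m) (path j′ _) = ≤-trans (+-monoʳ-< base (≤-<-trans (m⊓n≤m j j′) (recompute< j<m))) base+m≤r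

    open RainbowPaths adj col using (Edge)

    edge-sym : ∀ {x y} → Edge x y → Edge y x
    edge-sym {x} {y} e = trans (adj-sym y x) e

    edge-col-sym : ∀ {x y} → Edge x y → col x y ≡ col y x
    edge-col-sym {x} {y} = col-sym x y

    open RainbowPaths.Symmetric adj col (λ {x} {y} → edge-sym {x} {y}) (λ {x} {y} → edge-col-sym {x} {y}) public

module Spine (T : Template) (cf cl base g′ m : ℕ) {k : ℕ} (P : WellFormed T k) where
  open Template T
  open Local T
  open HubGraph T cf cl base g′ m
  open Properties P
  open RainbowPaths adj col

  spineFrom : (u : ℕ) → Dec (u < m) → Vertex
  spineFrom u (yes u<m) = path u u<m
  spineFrom u (no _) = B

  spine : ℕ → Vertex
  spine zero = A
  spine (suc u) = spineFrom u (u <? m)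

  spine-path : ∀ j .(j<m : j < m) → spine (suc j) ≡ path j j<m
  spine-path j j<m with j <? m
  ... | yes _ = refl
  ... | no j≮m = ⊥-elim (j≮m (recompute< j<m))

  spine-end : spine (suc m) ≡ B
  spine-end with m <? m
  ... | yes m<m = ⊥-elim (n≮n m m<m)
  ... | no _ = refl

  position : Vertex → ℕ
  position (core a) = if isA a then 0 else suc m
  position (gadget _ _) = 0
  position (path j _) = suc j

  position-spine : ∀ u → u ≤ suc m → position (spine u) ≡ u
  position-spine zero _ = refl
  position-spine (suc u) u≤ with u <? m
  ... | yes _ = refl
  ... | no u≮m = cong suc (≤-antisym (≮⇒≥ u≮m) (≤-pred u≤))

  spine-injective : ∀ {u u′} → u ≤ suc m → u′ ≤ suc m → spine u ≡ spine u′ → u ≡ u′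
  spine-injective {u} {u′} u≤ u′≤ eq = trans (sym (position-spine u u≤)) (trans (cong position eq) (position-spine u′ u′≤))

  spine-isPath : ∀ u → 0 < u → u ≤ m → IsPathVertex (spine u)
  spine-isPath (suc u) _ u<m with u <? m
  ... | yes _ = tt
  ... | no u≮m = u≮m u<m

  spineCol : ℕ → ℕ
  spineCol zero = cf
  spineCol (suc u) = if (suc u ≡ᵇ m) then cl else base + u

  module _ (0<m : 0 < m) (S : LocalConditions.SpineCompatible T cf cl base) where
    open LocalConditions.SpineCompatible S

    spineCol⁻¹ : ℕ → ℕ
    spineCol⁻¹ x = if (x ≡ᵇ cf) then 0 else (if (x ≡ᵇ cl) then m else suc (x ∸ base))

    base+≢ : ∀ {x y} → y < base → base + x ≢ y
    base+≢ {x} y<base eq = <⇒≱ y<base (subst (base ≤_) eq (m≤m+n base x))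

    spineCol⁻¹-spineCol : ∀ u → u ≤ m → spineCol⁻¹ (spineCol u) ≡ u
    spineCol⁻¹-spineCol zero _ rewrite ≡ᵇ-refl cf = refl
    spineCol⁻¹-spineCol (suc u) u<m with suc u ≡ᵇ m in eq
    ... | true rewrite ≢⇒≡ᵇ-false cl cf (λ e → cf≢cl (sym e)) | ≡ᵇ-refl cl = sym (≡ᵇ-true⇒≡ _ _ eq)
    ... | false rewrite ≢⇒≡ᵇ-false (base + u) cf (base+≢ cf<base) | ≢⇒≡ᵇ-false (base + u) cl (base+≢ cl<base) =
      cong suc (m+n∸m≡n base u)

    spineCol-injective : ∀ {u u′} → u ≤ m → u′ ≤ m → spineCol u ≡ spineCol u′ → u ≡ u′
    spineCol-injective {u} {u′} u≤ u′≤ eq =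
      trans (sym (spineCol⁻¹-spineCol u u≤)) (trans (cong spineCol⁻¹ eq) (spineCol⁻¹-spineCol u′ u′≤))

    spineCol-below : ∀ u → u < m → spineCol u ≡ cf ⊎ base ≤ spineCol u
    spineCol-below zero _ = inj₁ refl
    spineCol-below (suc u) u<m rewrite ≢⇒≡ᵇ-false (suc u) m (<⇒≢ u<m) = inj₂ (m≤m+n base u)

    spineCol-above : ∀ u → 0 < u → spineCol u ≡ cl ⊎ base ≤ spineCol u
    spineCol-above (suc u) _ with suc u ≡ᵇ m
    ... | true = inj₁ refl
    ... | false = inj₂ (m≤m+n base u)

    spine-edge : ∀ u → u ≤ m → Edge (spine u) (spine (suc u)) × col (spine u) (spine (suc u)) ≡ spineCol u
    spine-edge zero _ with 0 <? m
    ... | yes _ = refl , refl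
    ... | no 0≮m = ⊥-elim (0≮m 0<m)
    spine-edge (suc u) u<m with u <? m | suc u <? m
    ... | no u≮m | _ = ⊥-elim (u≮m u<m)
    ... | yes _ | yes su<m rewrite ≡ᵇ-refl u | ≢⇒≡ᵇ-false (suc u) m (<⇒≢ su<m) =
      refl , cong (base +_) (m≤n⇒m⊓n≡m (n≤1+n u))
    ... | yes _ | no su≮m with ≤-antisym u<m (≮⇒≥ su≮m)
    ... | refl rewrite ≡ᵇ-refl (suc u) = refl , refl

    countFrom : ℕ → ℕ → List ℕ
    countFrom a zero = []
    countFrom a (suc k) = a ∷ countFrom (suc a) k

    ∈-countFrom⁻ : ∀ {u} a k → u ∈ countFrom a k → a ≤ u × u < a + k
    ∈-countFrom⁻ a (suc k) (here refl) = ≤-refl , subst (a <_) (sym (+-suc a k)) (s≤s (m≤m+n a k))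
    ∈-countFrom⁻ {u} a (suc k) (there u∈) with ∈-countFrom⁻ (suc a) k u∈
    ... | a<u , u<a+k = ≤-trans (n≤1+n a) a<u , subst (u <_) (sym (+-suc a k)) u<a+k

    segment : ℕ → ℕ → List Vertex
    segment a k = map spine (countFrom a k)

    ∈-segment⁻ : ∀ {z} a k → z ∈ segment a k → Σ[ u ∈ ℕ ] (a ≤ u × u < a + k × z ≡ spine u)
    ∈-segment⁻ a k z∈ with ∈-map⁻ spine z∈
    ... | u , u∈ , eq = u , proj₁ (∈-countFrom⁻ a k u∈) , proj₂ (∈-countFrom⁻ a k u∈) , eq

    stretch : ℕ → ℕ → List Vertex
    stretch a k = via (spine a) (segment (suc a) k) (spine (suc (a + k)))

    stretch-suc : ∀ a k → stretch a (suc k) ≡ spine a ∷ stretch (suc a) k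
    stretch-suc a k rewrite +-suc a k = refl

    ∈-stretch⁻ : ∀ {z} a k → z ∈ stretch a k → Σ[ u ∈ ℕ ] (a ≤ u × u ≤ suc (a + k) × z ≡ spine u)
    ∈-stretch⁻ a k (here refl) = a , ≤-refl , ≤-trans (m≤m+n a k) (n≤1+n _) , refl
    ∈-stretch⁻ a k (there z∈) with ∈-++⁻ (segment (suc a) k) z∈
    ... | inj₁ z∈seg with ∈-segment⁻ (suc a) k z∈seg
    ...   | u , a<u , u<a+k , eq = u , ≤-trans (n≤1+n a) a<u , <⇒≤ u<a+k , eq
    ∈-stretch⁻ a k (there z∈) | inj₂ (here refl) = suc (a + k) , ≤-trans (m≤m+n a k) (n≤1+n _) , ≤-refl , refl

    SpineColour : ℕ → ℕ → ℕ → Set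
    SpineColour lo hi x = Σ[ u ∈ ℕ ] (lo ≤ u × u ≤ hi × x ≡ spineCol u)

    colours-stretch : ∀ a k → a + k ≤ m → ∀ {x} → x ∈ colours (stretch a k) → SpineColour a (a + k) x
    colours-stretch a zero a≤m (here refl) rewrite +-identityʳ a = a , ≤-refl , ≤-refl , proj₂ (spine-edge a a≤m)
    colours-stretch a (suc k) a+k<m {x} x∈ with subst (λ vs → x ∈ colours vs) (stretch-suc a k) x∈
    ... | here refl = a , ≤-refl , m≤m+n a (suc k) , proj₂ (spine-edge a (≤-trans (m≤m+n a (suc k)) a+k<m))
    ... | there x∈′ with colours-stretch (suc a) k (subst (_≤ m) (+-suc a k) a+k<m) x∈′
    ...   | u , a<u , u≤ , eq = u , ≤-trans (n≤1+n a) a<u , subst (u ≤_) (sym (+-suc a k)) u≤ , eq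

    stretch-rainbow : ∀ a k → a + k ≤ m → RainbowPath (stretch a k)
    stretch-rainbow a zero a≤m rewrite +-identityʳ a = record
      { distinct = (spine-a≢ All.∷ All.[]) ∷ All.[] ∷ []
      ; linked   = proj₁ (spine-edge a a≤m) ∷ [-]
      ; rainbow  = All.[] ∷ []
      }
      where
      spine-a≢ : spine a ≢ spine (suc a)
      spine-a≢ eq with spine-injective (≤-trans a≤m (n≤1+n m)) (s≤s a≤m) eq
      ... | ()
    stretch-rainbow a (suc k) a+k<m = subst RainbowPath (sym (stretch-suc a k)) (prepend (stretch-rainbow (suc a) k a+k≤m))
      where
      a+k≤m : suc a + k ≤ m
      a+k≤m = subst (_≤ m) (+-suc a k) a+k<m
      a≤m : a ≤ m
      a≤m = ≤-trans (m≤m+n a (suc k)) a+k<m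
      vertex-new : ∀ {z} → z ∈ stretch (suc a) k → spine a ≢ z
      vertex-new z∈ eq with ∈-stretch⁻ (suc a) k z∈
      ... | u , a<u , u≤ , eq′ =
        <-irrefl (spine-injective (≤-trans a≤m (n≤1+n m)) (≤-trans u≤ (s≤s a+k≤m)) (trans eq eq′)) a<u
      colour-new : ∀ {x} → x ∈ colours (stretch (suc a) k) → col (spine a) (spine (suc a)) ≢ x
      colour-new x∈ eq with colours-stretch (suc a) k a+k≤m x∈
      ... | u , a<u , u≤ , eq′ =
        <-irrefl (spineCol-injective a≤m (≤-trans u≤ a+k≤m) (trans (sym (proj₂ (spine-edge a a≤m))) (trans eq eq′))) a<u
      prepend : RainbowPath (stretch (suc a) k) → RainbowPath (spine a ∷ stretch (suc a) k)
      prepend p = record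
        { distinct = All.tabulate vertex-new ∷ distinct p
        ; linked   = proj₁ (spine-edge a a≤m) ∷ linked p
        ; rainbow  = All.tabulate colour-new ∷ rainbow p
        }

    record OnSpine (lo hi : ℕ) (z : Vertex) : Set where
      field
        isPath : IsPathVertex z
        lower  : lo ≤ position z
        upper  : position z < hi
    open OnSpine

    segment-onSpine : ∀ {z} a k → 0 < a → a + k ≤ suc m → z ∈ segment a k → OnSpine a (a + k) z
    segment-onSpine a k 0<a a+k≤ z∈ with ∈-segment⁻ a k z∈
    ... | u , a≤u , u<a+k , refl = record
      { isPath = spine-isPath u (≤-trans 0<a a≤u) (≤-pred (≤-trans u<a+k a+k≤))
      ; lower  = subst (a ≤_) (sym (position-spine u u≤)) a≤u
      ; upper  = subst (_< a + k) (sym (position-spine u u≤)) u<a+k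
      }
      where
      u≤ : u ≤ suc m
      u≤ = ≤-trans (<⇒≤ u<a+k) a+k≤

    via-cong : ∀ {u u′ xs v v′} → u ≡ u′ → v ≡ v′ → via u xs v ≡ via u′ xs v′
    via-cong refl refl = refl

    down : ℕ → List Vertex
    down j = reverse (segment 1 j)

    down-rainbow : ∀ j .(j<m : j < m) → RainbowVia (path j j<m) (down j) A
    down-rainbow j j<m = subst RainbowPath (via-cong (spine-path j j<m) refl)
      (reverse-path {spine 0} {segment 1 j} {spine (suc j)} (stretch-rainbow 0 j (<⇒≤ (recompute< j<m))))

    ∈-down⁻ : ∀ {z} j → j < m → z ∈ down j → OnSpine 1 (suc j) z
    ∈-down⁻ j j<m z∈ = segment-onSpine 1 j (s≤s z≤n) (s≤s (<⇒≤ j<m)) (reverse⁻ z∈)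

    colours-down : ∀ {x} j .(j<m : j < m) → x ∈ colours (via (path j j<m) (down j) A) → SpineColour 0 j x
    colours-down {x} j j<m x∈ = colours-stretch 0 j (<⇒≤ (recompute< j<m))
      (∈-colours-reverse-path⁻ (stretch-rainbow 0 j (<⇒≤ (recompute< j<m)))
        (subst (λ vs → x ∈ colours vs) (via-cong (sym (spine-path j j<m)) refl) x∈))

    up : ℕ → List Vertex
    up j = segment (suc (suc j)) (m ∸ suc j)

    up-end : ∀ j → j < m → suc (suc j + (m ∸ suc j)) ≡ suc m
    up-end j j<m = cong suc (m+[n∸m]≡n j<m)

    up-endpoints : ∀ j .(j<m : j < m) → stretch (suc j) (m ∸ suc j) ≡ via (path j j<m) (up j) B
    up-endpoints j j<m = via-cong (spine-path j j<m) (trans (cong spine (up-end j (recompute< j<m))) spine-end)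

    up-rainbow : ∀ j .(j<m : j < m) → RainbowVia (path j j<m) (up j) B
    up-rainbow j j<m = subst RainbowPath (up-endpoints j j<m)
      (stretch-rainbow (suc j) (m ∸ suc j) (≤-reflexive (m+[n∸m]≡n (recompute< j<m))))

    ∈-up⁻ : ∀ {z} j → j < m → z ∈ up j → OnSpine (suc (suc j)) (suc m) z
    ∈-up⁻ {z} j j<m z∈ = subst (λ h → OnSpine (suc (suc j)) h z) (up-end j j<m)
      (segment-onSpine (suc (suc j)) (m ∸ suc j) (s≤s z≤n) (≤-reflexive (up-end j j<m)) z∈)

    colours-up : ∀ {x} j .(j<m : j < m) → x ∈ colours (via (path j j<m) (up j) B) → SpineColour (suc j) m x
    colours-up {x} j j<m x∈
      with colours-stretch (suc j) (m ∸ suc j) (≤-reflexive (m+[n∸m]≡n (recompute< j<m)))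
             (subst (λ vs → x ∈ colours vs) (sym (up-endpoints j j<m)) x∈)
    ... | u , j<u , u≤ , eq = u , j<u , subst (u ≤_) (m+[n∸m]≡n (recompute< j<m)) u≤ , eq

    between : ℕ → ℕ → List Vertex
    between j j′ = segment (suc (suc j)) (j′ ∸ suc j)

    between-rainbow : ∀ j j′ .(j<m : j < m) .(j′<m : j′ < m) → j < j′ → RainbowVia (path j j<m) (between j j′) (path j′ j′<m)
    between-rainbow j j′ j<m j′<m j<j′ =
      subst RainbowPath (via-cong (spine-path j j<m) (trans (cong (λ x → spine (suc x)) (m+[n∸m]≡n j<j′)) (spine-path j′ j′<m)))
        (stretch-rainbow (suc j) (j′ ∸ suc j) (≤-trans (≤-reflexive (m+[n∸m]≡n j<j′)) (<⇒≤ (recompute< j′<m))))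

    ∈-between⁻ : ∀ {z} j j′ → j < j′ → j′ < m → z ∈ between j j′ → OnSpine (suc (suc j)) (suc j′) z
    ∈-between⁻ {z} j j′ j<j′ j′<m z∈ = subst (λ h → OnSpine (suc (suc j)) h z) (cong suc (m+[n∸m]≡n j<j′))
      (segment-onSpine (suc (suc j)) (j′ ∸ suc j) (s≤s z≤n) (s≤s (≤-trans (≤-reflexive (m+[n∸m]≡n j<j′)) (<⇒≤ j′<m))) z∈)

    low-spineCol-forbidden : ∀ u → u < m → ¬ (spineCol u < base × spineCol u ≢ cf)
    low-spineCol-forbidden u u<m (below , ≢cf) with spineCol-below u u<m
    ... | inj₁ eq = ≢cf eq
    ... | inj₂ base≤ = <⇒≱ below base≤

    high-spineCol-forbidden : ∀ u → 0 < u → ¬ (spineCol u < base × spineCol u ≢ cl)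
    high-spineCol-forbidden u 0<u (below , ≢cl) with spineCol-above u 0<u
    ... | inj₁ eq = ≢cl eq
    ... | inj₂ base≤ = <⇒≱ below base≤

    ∉path-intoCopy : ∀ i {z xs} → z ∈ map (intoCopy i) xs → ¬ IsPathVertex z
    ∉path-intoCopy i z∈ with ∈-map⁻ (intoCopy i) z∈
    ... | x , _ , refl = intoCopy-not-path i x

    ∉path-reverse-intoCopy : ∀ i {z xs} → z ∈ reverse (map (intoCopy i) xs) → ¬ IsPathVertex z
    ∉path-reverse-intoCopy i {xs = xs} z∈ = ∉path-intoCopy i (reverse⁻ {xs = map (intoCopy i) xs} z∈)

    route′ : List Vertex
    route′ = map (intoCopy Fin.zero) route

    route′-rainbow : RainbowVia A route′ B
    route′-rainbow = Copy.map-path Fin.zero route-rainbow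

    route′-colours : ∀ {x} → x ∈ colours (via A route′ B) → x < base × x ≢ cf × x ≢ cl
    route′-colours x∈ = route-colours (Copy.∈-colours-map-path⁻ Fin.zero route-rainbow x∈)

    viaRoute : ℕ → List Vertex
    viaRoute j = down j ++ A ∷ route′

    viaRoute-rainbow : ∀ j .(j<m : j < m) → RainbowVia (path j j<m) (viaRoute j) B
    viaRoute-rainbow j j<m = join-via (down j) route′ (down-rainbow j j<m) route′-rainbow vertices# colours#
      where
      isPath-start : ∀ {z} → z ∈ path j j<m ∷ down j → IsPathVertex z
      isPath-start (here refl) = tt
      isPath-start (there z∈) = isPath (∈-down⁻ j (recompute< j<m) z∈)
      vertices# : Disjoint (path j j<m ∷ down j) (route′ ++ B ∷ [])
      vertices# (z∈₁ , z∈₂) with ∈-++⁻ route′ z∈₂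
      ... | inj₁ z∈route = ∉path-intoCopy Fin.zero z∈route (isPath-start z∈₁)
      ... | inj₂ (here refl) = isPath-start z∈₁
      colours# : Disjoint (colours (via (path j j<m) (down j) A)) (colours (via A route′ B))
      colours# (x∈₁ , x∈₂) with colours-down j j<m x∈₁ | route′-colours x∈₂
      ... | u , _ , u≤j , refl | below , ≢cf , _ =
        low-spineCol-forbidden u (≤-<-trans u≤j (recompute< j<m)) (below , ≢cf)

    ∈-viaRoute⁻ : ∀ {z} j .(j<m : j < m) → z ∈ path j j<m ∷ viaRoute j →
                  (IsPathVertex z × position z ≤ suc j) ⊎ ¬ IsPathVertex z
    ∈-viaRoute⁻ j j<m (here refl) = inj₁ (tt , ≤-refl)
    ∈-viaRoute⁻ {z} j j<m (there z∈) with ∈-++⁻ (down j) z∈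
    ... | inj₁ z∈down = inj₁ (isPath on , <⇒≤ (upper on))
      where
      on : OnSpine 1 (suc j) z
      on = ∈-down⁻ j (recompute< j<m) z∈down
    ... | inj₂ (here refl) = inj₂ λ ()
    ... | inj₂ (there z∈route) = inj₂ (∉path-intoCopy Fin.zero z∈route)

    colours-viaRoute : ∀ {x} j .(j<m : j < m) → x ∈ colours (via (path j j<m) (viaRoute j) B) →
                       SpineColour 0 j x ⊎ (x < base × x ≢ cf × x ≢ cl)
    colours-viaRoute j j<m x∈ with colours-via-++⁻ (path j j<m) (down j) A route′ B x∈
    ... | inj₁ x∈down = inj₁ (colours-down j j<m x∈down)
    ... | inj₂ x∈route = inj₂ (route′-colours x∈route)

    upward : ℕ → List Vertex
    upward j = reverse (up j)

    upward-rainbow : ∀ j .(j<m : j < m) → RainbowVia B (upward j) (path j j<m)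
    upward-rainbow j j<m = reverse-path (up-rainbow j j<m)

    ∈-upward⁻ : ∀ {z} j .(j<m : j < m) → z ∈ upward j ++ path j j<m ∷ [] → IsPathVertex z × suc j ≤ position z
    ∈-upward⁻ {z} j j<m z∈ with ∈-++⁻ (upward j) z∈
    ... | inj₁ z∈up = isPath on , ≤-trans (n≤1+n _) (lower on)
      where
      on : OnSpine (suc (suc j)) (suc m) z
      on = ∈-up⁻ j (recompute< j<m) (reverse⁻ z∈up)
    ... | inj₂ (here refl) = tt , ≤-refl

    colours-upward : ∀ {x} j .(j<m : j < m) → x ∈ colours (via B (upward j) (path j j<m)) → SpineColour (suc j) m x
    colours-upward j j<m x∈ = colours-up j j<m (∈-colours-reverse-path⁻ (up-rainbow j j<m) x∈)

    pair-path-path : ∀ j j′ .(j<m : j < m) .(j′<m : j′ < m) → j < j′ → RainbowPair (path j j<m) (path j′ j′<m)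
    pair-path-path j j′ j<m j′<m j<j′ = record
      { inner₁ = between j j′
      ; inner₂ = viaRoute j ++ B ∷ upward j′
      ; path₁ = between-rainbow j j′ j<m j′<m j<j′
      ; path₂ = join-via (viaRoute j) (upward j′) (viaRoute-rainbow j j<m) (upward-rainbow j′ j′<m) vertices# colours#
      ; inner₁≢inner₂ = λ eq → isPath (∈-between⁻ j j′ j<j′ (recompute< j′<m) (subst (A ∈_) (sym eq) A∈inner₂))
      ; disjoint = inner#
      }
      where
      A∈inner₂ : A ∈ viaRoute j ++ B ∷ upward j′
      A∈inner₂ = ∈-++⁺ˡ (∈-++⁺ʳ (down j) (here refl))
      vertices# : Disjoint (path j j<m ∷ viaRoute j) (upward j′ ++ path j′ j′<m ∷ [])
      vertices# (z∈₁ , z∈₂) with ∈-viaRoute⁻ j j<m z∈₁ | ∈-upward⁻ j′ j′<m z∈₂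
      ... | inj₁ (_ , pos≤) | _ , ≤pos = <⇒≱ (s≤s j<j′) (≤-trans ≤pos pos≤)
      ... | inj₂ ¬path | isPath′ , _ = ¬path isPath′
      colours# : Disjoint (colours (via (path j j<m) (viaRoute j) B)) (colours (via B (upward j′) (path j′ j′<m)))
      colours# (x∈₁ , x∈₂) with colours-upward j′ j′<m x∈₂
      ... | u′ , j′<u′ , u′≤m , refl with colours-viaRoute j j<m x∈₁
      ... | inj₁ (u , _ , u≤j , eq) =
        <⇒≱ j<j′ (≤-trans (n≤1+n j′) (≤-trans j′<u′ (≤-trans (≤-reflexive (spineCol-injective u′≤m u≤m eq)) u≤j)))
        where
        u≤m : u ≤ m
        u≤m = ≤-trans u≤j (≤-trans (<⇒≤ j<j′) (<⇒≤ (recompute< j′<m)))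
      ... | inj₂ (below , _ , ≢cl) = high-spineCol-forbidden u′ (≤-trans (s≤s z≤n) j′<u′) (below , ≢cl)
      inner# : Disjoint (between j j′) (viaRoute j ++ B ∷ upward j′)
      inner# (z∈₁ , z∈₂) with ∈-between⁻ j j′ j<j′ (recompute< j′<m) z∈₁ | ∈-++⁻ (viaRoute j) z∈₂
      ... | on | inj₁ z∈route with ∈-viaRoute⁻ j j<m (there z∈route)
      ...   | inj₁ (_ , pos≤) = <⇒≱ (s≤s ≤-refl) (≤-trans (lower on) pos≤)
      ...   | inj₂ ¬path = ¬path (isPath on)
      inner# (z∈₁ , z∈₂) | on | inj₂ (here refl) = isPath on
      inner# (z∈₁ , z∈₂) | on | inj₂ (there z∈up) =
        <⇒≱ (upper on) (≤-trans (n≤1+n _) (lower (∈-up⁻ j′ (recompute< j′<m) (reverse⁻ z∈up))))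

    separated : ∀ {xs ys} → (∀ {z} → z ∈ xs → IsPathVertex z) → (∀ {z} → z ∈ ys → ¬ IsPathVertex z) → Disjoint xs ys
    separated onPath offPath (z∈xs , z∈ys) = offPath z∈ys (onPath z∈xs)

    onPath-down : ∀ {z} j .(j<m : j < m) → z ∈ path j j<m ∷ down j → IsPathVertex z
    onPath-down j j<m (here refl) = tt
    onPath-down j j<m (there z∈) = isPath (∈-down⁻ j (recompute< j<m) z∈)

    onPath-up : ∀ {z} j .(j<m : j < m) → z ∈ path j j<m ∷ up j → IsPathVertex z
    onPath-up j j<m (here refl) = tt
    onPath-up j j<m (there z∈) = isPath (∈-up⁻ j (recompute< j<m) z∈)

    offPath-back : ∀ i {z xs w} → ¬ IsPathVertex w → z ∈ reverse (map (intoCopy i) xs) ++ w ∷ [] → ¬ IsPathVertex z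
    offPath-back i {xs = xs} ¬w z∈ with ∈-++⁻ (reverse (map (intoCopy i) xs)) z∈
    ... | inj₁ z∈xs = ∉path-reverse-intoCopy i {xs = xs} z∈xs
    ... | inj₂ (here refl) = ¬w

    down#up : ∀ j .(j<m : j < m) → Disjoint (down j) (up j)
    down#up j j<m (z∈₁ , z∈₂) =
      <⇒≱ (upper (∈-down⁻ j (recompute< j<m) z∈₁)) (≤-trans (n≤1+n _) (lower (∈-up⁻ j (recompute< j<m) z∈₂)))

    pair-path-A : ∀ j .(j<m : j < m) → RainbowPair (path j j<m) A
    pair-path-A j j<m = record
      { inner₁ = down j
      ; inner₂ = up j ++ B ∷ reverse route′
      ; path₁ = down-rainbow j j<m
      ; path₂ = join-via (up j) (reverse route′) (up-rainbow j j<m) (reverse-path route′-rainbow)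
                  (separated (onPath-up j j<m) (offPath-back Fin.zero {xs = route} λ ())) colours#
      ; inner₁≢inner₂ = λ eq → isPath (∈-down⁻ j (recompute< j<m) (subst (B ∈_) (sym eq) (∈-++⁺ʳ (up j) (here refl))))
      ; disjoint = inner#
      }
      where
      colours# : Disjoint (colours (via (path j j<m) (up j) B)) (colours (via B (reverse route′) A))
      colours# (x∈₁ , x∈₂) with colours-up j j<m x∈₁ | route′-colours (∈-colours-reverse-path⁻ route′-rainbow x∈₂)
      ... | u , j<u , _ , refl | below , _ , ≢cl = high-spineCol-forbidden u (≤-trans (s≤s z≤n) j<u) (below , ≢cl)
      inner# : Disjoint (down j) (up j ++ B ∷ reverse route′)
      inner# (z∈₁ , z∈₂) with ∈-down⁻ j (recompute< j<m) z∈₁ | ∈-++⁻ (up j) z∈₂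
      ... | _ | inj₁ z∈up = down#up j j<m (z∈₁ , z∈up)
      ... | on | inj₂ (here refl) = isPath on
      ... | on | inj₂ (there z∈route) = ∉path-reverse-intoCopy Fin.zero {xs = route} z∈route (isPath on)

    pair-path-B : ∀ j .(j<m : j < m) → RainbowPair (path j j<m) B
    pair-path-B j j<m = record
      { inner₁ = up j
      ; inner₂ = viaRoute j
      ; path₁ = up-rainbow j j<m
      ; path₂ = viaRoute-rainbow j j<m
      ; inner₁≢inner₂ = λ eq → isPath (∈-up⁻ j (recompute< j<m) (subst (A ∈_) (sym eq) (∈-++⁺ʳ (down j) (here refl))))
      ; disjoint = inner#
      }
      where
      inner# : Disjoint (up j) (viaRoute j)
      inner# (z∈₁ , z∈₂) with ∈-up⁻ j (recompute< j<m) z∈₁ | ∈-viaRoute⁻ j j<m (there z∈₂)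
      ... | on | inj₁ (_ , pos≤) = <⇒≱ (s≤s ≤-refl) (≤-trans (lower on) pos≤)
      ... | on | inj₂ ¬path = ¬path (isPath on)

    module _ (j : ℕ) .(j<m : j < m) (i : Fin g) (y : Fin (c + s)) (H : LocalConditions.ToHubs T cf cl base y) where
      open LocalConditions.ToHubs H

      toA′ toB′ : List Vertex
      toA′ = map (intoCopy i) toA
      toB′ = map (intoCopy i) toB

      Y : Vertex
      Y = intoCopy i y

      toA′-rainbow : RainbowVia Y toA′ A
      toA′-rainbow = Copy.map-path i toA-rainbow

      toB′-rainbow : RainbowVia Y toB′ B
      toB′-rainbow = Copy.map-path i toB-rainbow

      colours#A : Disjoint (colours (via (path j j<m) (down j) A)) (colours (via A (reverse toA′) Y))
      colours#A (x∈₁ , x∈₂) with colours-down j j<m x∈₁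
                                | toA-colours (Copy.∈-colours-map-path⁻ i toA-rainbow (∈-colours-reverse-path⁻ toA′-rainbow x∈₂))
      ... | u , _ , u≤j , refl | c<base , ≢cf = low-spineCol-forbidden u (≤-<-trans u≤j (recompute< j<m)) (c<base , ≢cf)

      colours#B : Disjoint (colours (via (path j j<m) (up j) B)) (colours (via B (reverse toB′) Y))
      colours#B (x∈₁ , x∈₂) with colours-up j j<m x∈₁
                                | toB-colours (Copy.∈-colours-map-path⁻ i toB-rainbow (∈-colours-reverse-path⁻ toB′-rainbow x∈₂))
      ... | u , j<u , _ , refl | c<base , ≢cl = high-spineCol-forbidden u (≤-trans (s≤s z≤n) j<u) (c<base , ≢cl)

      inner₁ inner₂ : List Vertex
      inner₁ = down j ++ A ∷ reverse toA′
      inner₂ = up j ++ B ∷ reverse toB′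

      A∉inner₂ : A ∈ inner₂ → ⊥
      A∉inner₂ A∈ with ∈-++⁻ (up j) A∈
      ... | inj₁ A∈up = isPath (∈-up⁻ j (recompute< j<m) A∈up)
      ... | inj₂ (there A∈toB) = hubA∉toB (Copy.∈-map-injective i {hubA} {toB} (reverse⁻ A∈toB))

      inner# : Disjoint inner₁ inner₂
      inner# (z∈₁ , z∈₂) with ∈-++⁻ (down j) z∈₁ | ∈-++⁻ (up j) z∈₂
      ... | inj₁ z∈down | inj₁ z∈up = down#up j j<m (z∈down , z∈up)
      ... | inj₁ z∈down | inj₂ (here refl) = isPath (∈-down⁻ j (recompute< j<m) z∈down)
      ... | inj₁ z∈down | inj₂ (there z∈toB) =
        ∉path-reverse-intoCopy i {xs = toB} z∈toB (isPath (∈-down⁻ j (recompute< j<m) z∈down))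
      ... | inj₂ (here refl) | _ = A∉inner₂ z∈₂
      ... | inj₂ (there z∈toA) | inj₁ z∈up =
        ∉path-reverse-intoCopy i {xs = toA} z∈toA (isPath (∈-up⁻ j (recompute< j<m) z∈up))
      ... | inj₂ (there z∈toA) | inj₂ (here refl) = hubB∉toA (Copy.∈-map-injective i {hubB} {toA} (reverse⁻ z∈toA))
      ... | inj₂ (there z∈toA) | inj₂ (there z∈toB) with ∈-map⁻ (intoCopy i) (reverse⁻ {xs = toA′} z∈toA)
      ...   | x , x∈toA , refl = toA#toB (x∈toA , Copy.∈-map-injective i (reverse⁻ {xs = toB′} z∈toB))

      pair-path-copy : RainbowPair (path j j<m) Y
      pair-path-copy = record
        { inner₁ = inner₁
        ; inner₂ = inner₂
        ; path₁ = join-via (down j) (reverse toA′) (down-rainbow j j<m) (reverse-path toA′-rainbow)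
                    (separated (onPath-down j j<m) (offPath-back i {xs = toA} (intoCopy-not-path i y))) colours#A
        ; path₂ = join-via (up j) (reverse toB′) (up-rainbow j j<m) (reverse-path toB′-rainbow)
                    (separated (onPath-up j j<m) (offPath-back i {xs = toB} (intoCopy-not-path i y))) colours#B
        ; inner₁≢inner₂ = λ eq → A∉inner₂ (subst (A ∈_) eq (∈-++⁺ʳ (down j) (here refl)))
        ; disjoint = inner#
        }

module Arcs (T : Template) where
  open Template T
  open Local T

  coreArcs : List (Fin c × Fin c)
  coreArcs = filterᵇ (λ (a , b) → coreAdj a b) (cartesianProduct (allFin c) (allFin c))

  allLocal : List (Fin c ⊎ Fin s)
  allLocal = map inj₁ (allFin c) ++ map inj₂ (allFin s)

  ∈-allLocal : ∀ p → p ∈ allLocal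
  ∈-allLocal (inj₁ a) = ∈-++⁺ˡ (∈-map⁺ inj₁ (∈-allFin a))
  ∈-allLocal (inj₂ t) = ∈-++⁺ʳ (map inj₁ (allFin c)) (∈-map⁺ inj₂ (∈-allFin t))

  touchesGadget : Fin c ⊎ Fin s → Fin c ⊎ Fin s → Bool
  touchesGadget (inj₁ _) (inj₁ _) = false
  touchesGadget _ _ = true

  gadgetArcs : List ((Fin c ⊎ Fin s) × (Fin c ⊎ Fin s))
  gadgetArcs = filterᵇ (λ (p , q) → touchesGadget p q ∧ adj₁ p q) (cartesianProduct allLocal allLocal)

spineEdgeCount : ℕ → ℕ
spineEdgeCount zero = 0
spineEdgeCount (suc j) = suc (suc j)

<spineEdgeCount : ∀ {m u} → 0 < m → u ≤ m → u < spineEdgeCount m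
<spineEdgeCount {suc m} _ u≤ = s≤s u≤

module HubGraphBound (T : Template) (cf cl base g′ m : ℕ) {k : ℕ} (P : WellFormed T k) (L : LocalRainbow T)
                (compatible : 0 < m → LocalConditions.SpineCompatible T cf cl base) where
  open Template T
  open Local T
  open Arcs T
  open HubGraph T cf cl base g′ m
  open Properties P
  open Spine T cf cl base g′ m P
  open RainbowPaths adj col
  open LocalRainbow L

  inCopy : ∀ i x y {u v} → intoCopy i x ≡ u → intoCopy i y ≡ v → u ≢ v → RainbowPair u v
  inCopy i x y refl refl u≢v = Copy.map-pair i (oneCopy x y (λ eq → u≢v (cong (intoCopy i) eq)))

  inTwoCopies : ∀ i j → i ≢ j → ∀ t t′ → RainbowPair (gadget i t) (gadget j t′)
  inTwoCopies i j i≢j t t′ =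
    subst₂ RainbowPair (intoCopies-left i j t) (intoCopies-right i j t′) (Copies.map-pair i j i≢j (twoCopies t t′))

  fromSpine : ∀ j .(j<m : j < m) v → v ≢ path j j<m → RainbowPair (path j j<m) v
  fromSpine j j<m v v≢ = go v v≢
    where
    0<m : 0 < m
    0<m = positive j<m
    S : LocalConditions.SpineCompatible T cf cl base
    S = compatible 0<m
    open LocalConditions.SpineCompatible S
    go : ∀ v → v ≢ path j j<m → RainbowPair (path j j<m) v
    go (path j′ j′<m) v≢ with <-cmp j j′
    ... | tri< j<j′ _ _ = pair-path-path 0<m S j j′ j<m j′<m j<j′
    ... | tri≈ _ refl _ = ⊥-elim (v≢ refl)
    ... | tri> _ _ j′<j = RainbowPair-sym (pair-path-path 0<m S j′ j j′<m j<m j′<j)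
    go (core Fin.zero) _ = pair-path-A 0<m S j j<m
    go (core (Fin.suc Fin.zero)) _ = pair-path-B 0<m S j j<m
    go (core a@(Fin.suc (Fin.suc _))) _ = subst₂ RainbowPair refl (intoCopy-core Fin.zero a)
      (pair-path-copy 0<m S j j<m Fin.zero (a ↑ˡ s) (toHubs _ (λ ()) (λ ())))
    go (gadget i t) _ = subst₂ RainbowPair refl (intoCopy-gadget i t)
      (pair-path-copy 0<m S j j<m i (c ↑ʳ t) (toHubs _ (λ ()) (λ ())))

  hubGraph-rainbow : RainbowTwoConnected
  hubGraph-rainbow (path j j<m) v u≢v = fromSpine j j<m v (λ eq → u≢v (sym eq))
  hubGraph-rainbow u (path j j<m) u≢v = RainbowPair-sym (fromSpine j j<m u u≢v)
  hubGraph-rainbow (core a) (core b) = inCopy Fin.zero (a ↑ˡ s) (b ↑ˡ s) (intoCopy-core Fin.zero a) (intoCopy-core Fin.zero b)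
  hubGraph-rainbow (core a) (gadget i t) = inCopy i (a ↑ˡ s) (c ↑ʳ t) (intoCopy-core i a) (intoCopy-gadget i t)
  hubGraph-rainbow (gadget i t) (core a) = inCopy i (c ↑ʳ t) (a ↑ˡ s) (intoCopy-gadget i t) (intoCopy-core i a)
  hubGraph-rainbow (gadget i t) (gadget i′ t′) u≢v with i ≟ i′
  ... | yes refl = inCopy i (c ↑ʳ t) (c ↑ʳ t′) (intoCopy-gadget i t) (intoCopy-gadget i t′) u≢v
  ... | no i≢i′ = inTwoCopies i i′ i≢i′ t t′

  spineArc : ℕ → Vertex × Vertex
  spineArc u = spine u , spine (suc u)

  spineArcs : List (Vertex × Vertex)
  spineArcs = map spineArc (upTo (spineEdgeCount m)) ++ map (swap ∘ spineArc) (upTo (spineEdgeCount m))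

  ∈-spineArcs : ∀ {u} → 0 < m → u ≤ m → spineArc u ∈ spineArcs × swap (spineArc u) ∈ spineArcs
  ∈-spineArcs {u} 0<m u≤m =
    ∈-++⁺ˡ (∈-map⁺ spineArc u∈) , ∈-++⁺ʳ (map spineArc (upTo (spineEdgeCount m))) (∈-map⁺ (swap ∘ spineArc) u∈)
    where
    u∈ : u ∈ upTo (spineEdgeCount m)
    u∈ = ∈-upTo⁺ (<spineEdgeCount 0<m u≤m)

  coreArc : Fin c × Fin c → Vertex × Vertex
  coreArc (a , b) = core a , core b

  copyArc : Fin g → (Fin c ⊎ Fin s) × (Fin c ⊎ Fin s) → Vertex × Vertex
  copyArc i (p , q) = onCopy i p , onCopy i q

  copiesArcs : List (Fin g) → List (Vertex × Vertex)
  copiesArcs [] = []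
  copiesArcs (i ∷ is) = map (copyArc i) gadgetArcs ++ copiesArcs is

  length-copiesArcs : ∀ is → length (copiesArcs is) ≡ length is * length gadgetArcs
  length-copiesArcs [] = refl
  length-copiesArcs (i ∷ is) = trans (length-++ (map (copyArc i) gadgetArcs))
    (cong₂ _+_ (length-map (copyArc i) gadgetArcs) (length-copiesArcs is))

  ∈-copiesArcs : ∀ {i is a} → i ∈ is → a ∈ gadgetArcs → copyArc i a ∈ copiesArcs is
  ∈-copiesArcs {i} {_ ∷ _} (here refl) a∈ = ∈-++⁺ˡ (∈-map⁺ (copyArc i) a∈)
  ∈-copiesArcs {i} {i′ ∷ _} (there i∈) a∈ = ∈-++⁺ʳ (map (copyArc i′) gadgetArcs) (∈-copiesArcs i∈ a∈)

  arcs : List (Vertex × Vertex)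
  arcs = map coreArc coreArcs ++ (copiesArcs (allFin g) ++ spineArcs)

  length-arcs : length arcs ≡ length coreArcs + (g * length gadgetArcs + 2 * spineEdgeCount m)
  length-arcs = trans (length-++ (map coreArc coreArcs)) (cong₂ _+_ (length-map coreArc coreArcs)
    (trans (length-++ (copiesArcs (allFin g))) (cong₂ _+_
      (trans (length-copiesArcs (allFin g)) (cong (_* length gadgetArcs) (length-upTo′ g)))
      length-spineArcs)))
    where
    length-upTo′ : ∀ g → length (allFin g) ≡ g
    length-upTo′ g = length-tabulate {n = g} (λ x → x)
    length-spineArcs : length spineArcs ≡ 2 * spineEdgeCount m
    length-spineArcs = begin
      length spineArcs                                               ≡⟨ length-++ (map spineArc edges) ⟩
      length (map spineArc edges) + length (map (swap ∘ spineArc) edges) ≡⟨ cong₂ _+_ (length-map spineArc edges) (length-map (swap ∘ spineArc) edges) ⟩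
      length edges + length edges                                    ≡⟨ cong (λ l → l + l) (length-upTo (spineEdgeCount m)) ⟩
      spineEdgeCount m + spineEdgeCount m                            ≡⟨ cong (spineEdgeCount m +_) (sym (+-identityʳ _)) ⟩
      2 * spineEdgeCount m                                           ∎
      where
      open ≡-Reasoning
      edges : List ℕ
      edges = upTo (spineEdgeCount m)

  ∈-arcs-spine : ∀ {a} → a ∈ spineArcs → a ∈ arcs
  ∈-arcs-spine = ∈-++⁺ʳ (map coreArc coreArcs) ∘ ∈-++⁺ʳ (copiesArcs (allFin g))

  ∈-arcs-copy : ∀ i {p q} → touchesGadget p q ≡ true → adj₁ p q ≡ true → (onCopy i p , onCopy i q) ∈ arcs
  ∈-arcs-copy i {p} {q} touches e = ∈-++⁺ʳ (map coreArc coreArcs) (∈-++⁺ˡ (∈-copiesArcs (∈-allFin i)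
    (∈-filter⁺ (λ (p , q) → T? (touchesGadget p q ∧ adj₁ p q)) (∈-cartesianProduct⁺ (∈-allLocal p) (∈-allLocal q))
      (Equivalence.from T-≡ (cong₂ _∧_ touches e)))))

  arc-cong : ∀ {x x′ y y′} → x ≡ x′ → y ≡ y′ → (x , y) ∈ arcs → (x′ , y′) ∈ arcs
  arc-cong refl refl a∈ = a∈

  ∨-true⁻ : ∀ a b → (a ∨ b) ≡ true → a ≡ true ⊎ b ≡ true
  ∨-true⁻ true b _ = inj₁ refl
  ∨-true⁻ false b e = inj₂ e

  ∧-true⁻ : ∀ a b → (a ∧ b) ≡ true → a ≡ true × b ≡ true
  ∧-true⁻ true b e = refl , e

  arcs-complete : ∀ u v → adj u v ≡ true → (u , v) ∈ arcs
  arcs-complete (core a) (core b) e = ∈-++⁺ˡ (∈-map⁺ coreArc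
    (∈-filter⁺ (λ (a , b) → T? (coreAdj a b)) (∈-cartesianProduct⁺ (∈-allFin a) (∈-allFin b)) (Equivalence.from T-≡ e)))
  arcs-complete (core a) (gadget i t) e = ∈-arcs-copy i {inj₁ a} {inj₂ t} refl e
  arcs-complete (gadget i t) (core a) e = ∈-arcs-copy i {inj₂ t} {inj₁ a} refl e
  arcs-complete (gadget i t) (gadget i′ t′) e with ∧-true⁻ (toℕ i ≡ᵇ toℕ i′) (gadgetAdj t t′) e
  ... | same , e′ with toℕ-injective (≡ᵇ-true⇒≡ (toℕ i) (toℕ i′) same)
  ... | refl = ∈-arcs-copy i {inj₂ t} {inj₂ t′} refl e′
  arcs-complete (core Fin.zero) (path j j<m) e with ≡ᵇ-true⇒≡ j 0 (trans (sym (∨-identityʳ _)) e)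
  ... | refl = arc-cong refl (spine-path 0 j<m) (∈-arcs-spine (proj₁ (∈-spineArcs (recompute< j<m) z≤n)))
  arcs-complete (path j j<m) (core Fin.zero) e with ≡ᵇ-true⇒≡ j 0 (trans (sym (∨-identityʳ _)) e)
  ... | refl = arc-cong (spine-path 0 j<m) refl (∈-arcs-spine (proj₂ (∈-spineArcs (recompute< j<m) z≤n)))
  arcs-complete (core (Fin.suc Fin.zero)) (path j j<m) e with ≡ᵇ-true⇒≡ (suc j) m e
  ... | refl = arc-cong spine-end (spine-path j j<m) (∈-arcs-spine (proj₂ (∈-spineArcs (s≤s z≤n) ≤-refl)))
  arcs-complete (path j j<m) (core (Fin.suc Fin.zero)) e with ≡ᵇ-true⇒≡ (suc j) m e
  ... | refl = arc-cong (spine-path j j<m) spine-end (∈-arcs-spine (proj₁ (∈-spineArcs (s≤s z≤n) ≤-refl)))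
  arcs-complete (path j j<m) (path j′ j′<m) e with ∨-true⁻ (suc j ≡ᵇ j′) (suc j′ ≡ᵇ j) e
  ... | inj₁ e′ with ≡ᵇ-true⇒≡ (suc j) j′ e′
  ...   | refl = arc-cong (spine-path j j<m) (spine-path j′ j′<m)
                   (∈-arcs-spine (proj₁ (∈-spineArcs (positive j<m) (<⇒≤ (recompute< j′<m)))))
  arcs-complete (path j j<m) (path j′ j′<m) e | inj₂ e′ with ≡ᵇ-true⇒≡ (suc j′) j e′
  ...   | refl = arc-cong (spine-path j j<m) (spine-path j′ j′<m)
                   (∈-arcs-spine (proj₂ (∈-spineArcs (positive j<m) (<⇒≤ (recompute< j<m)))))

  3≤n : 3 ≤ n
  3≤n with size | WellFormed.size-positive P
  ... | suc s′ | _ = s≤s (s≤s (≤-trans (s≤s z≤n) (m≤n+m (suc (s′ + g′ * suc s′ + m)) extra)))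

  module _ {r : ℕ} (k≤r : k ≤ r) (cf<r : cf < r) (cl<r : cl < r) (base+m≤r : base + m ≤ r) where
    open Realisation n r to from from∘to to∘from adj adj-sym adj-irrefl col col-sym (col-< k≤r cf<r cl<r base+m≤r)

    hubGraph-bound : T2Bound n r (λ e → 2 * e ≤ length coreArcs + (g * length gadgetArcs + 2 * spineEdgeCount m))
    hubGraph-bound = graph , twoConnected hubGraph-rainbow 3≤n , (colouring , rainbow2Connected hubGraph-rainbow) ,
      subst (2 * ∣E∣ graph ≤_) length-arcs (double-∣E∣≤ arcs arcs-complete)

T2Bound-map : ∀ {n r} {B B′ : ℕ → Set} → (∀ e → B e → B′ e) → T2Bound n r B → T2Bound n r B′
T2Bound-map f (G , 2-conn , rainbow , bound) = G , 2-conn , rainbow , f _ bound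

record Certificate (T : Template) (k gadgetEdges : ℕ) : Set where
  field
    wellFormed : WellFormed T k
    local  : LocalRainbow T
    coreArcs-length   : length (Arcs.coreArcs T) ≡ 4 * Template.extra T
    gadgetArcs-length : length (Arcs.gadgetArcs T) ≡ 2 * gadgetEdges

hubGraph : ∀ {T k e} → Certificate T k e → ∀ g′ m cf cl base r →
           (0 < m → LocalConditions.SpineCompatible T cf cl base) → k ≤ r → cf < r → cl < r → base + m ≤ r →
           let open Template T in
           T2Bound (2 + extra + (suc g′ * size + m)) r (λ E → E ≤ 2 * extra + (suc g′ * e + spineEdgeCount m))
hubGraph {T} {k} {e} C g′ m cf cl base r compatible k≤r cf<r cl<r base+m≤r =
  T2Bound-map halve (HubGraphBound.hubGraph-bound T cf cl base g′ m wellFormed local compatible k≤r cf<r cl<r base+m≤r)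
  where
  open Template T
  open Certificate C
  halve : ∀ E → 2 * E ≤ length (Arcs.coreArcs T) + (suc g′ * length (Arcs.gadgetArcs T) + 2 * spineEdgeCount m) →
          E ≤ 2 * extra + (suc g′ * e + spineEdgeCount m)
  halve E 2E≤ = *-cancelˡ-≤ 2 (subst (2 * E ≤_) arcs≡ 2E≤)
    where
    double : ∀ a g e s → 4 * a + (g * (2 * e) + 2 * s) ≡ 2 * (2 * a + (g * e + s))
    double = solve-∀
    arcs≡ : length (Arcs.coreArcs T) + (suc g′ * length (Arcs.gadgetArcs T) + 2 * spineEdgeCount m) ≡
            2 * (2 * extra + (suc g′ * e + spineEdgeCount m))
    arcs≡ = trans (cong₂ (λ a b → a + (suc g′ * b + 2 * spineEdgeCount m)) coreArcs-length gadgetArcs-length)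
                  (double extra (suc g′) e (spineEdgeCount m))

Paths : ℕ → Set
Paths k = List (Fin k) × List (Fin k)

module Decide {k : ℕ} (adj : Fin k → Fin k → Bool) (col : Fin k → Fin k → ℕ) where
  open RainbowPaths adj col

  rainbowPath? : ∀ vs → Dec (RainbowPath vs)
  rainbowPath? vs = map′ (λ ((u , l) , r) → record { distinct = u ; linked = l ; rainbow = r })
                         (λ p → (distinct p , linked p) , rainbow p)
    ((unique? _≟_ vs ×-dec linked? (λ x y → adj x y Bool.≟ true) vs) ×-dec unique? ℕ._≟_ (colours vs))

  IsPairVia : Fin k → Fin k → Paths k → Set
  IsPairVia u v (xs , ys) = RainbowVia u xs v × RainbowVia u ys v × xs ≢ ys × Disjoint xs ys

  isPairVia? : ∀ u v ps → Dec (IsPairVia u v ps)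
  isPairVia? u v (xs , ys) = rainbowPath? (via u xs v) ×-dec rainbowPath? (via u ys v)
    ×-dec ¬? (≡-dec _≟_ xs ys) ×-dec disjoint? _≟_ xs ys

  toPair : ∀ {u v} ps → IsPairVia u v ps → RainbowPair u v
  toPair (xs , ys) (p , q , xs≢ys , xs#ys) = record
    { inner₁ = xs ; inner₂ = ys ; path₁ = p ; path₂ = q ; inner₁≢inner₂ = xs≢ys ; disjoint = xs#ys }

  PairsVia : (Fin k → Fin k → Paths k) → Set
  PairsVia table = ∀ x y → x ≡ y ⊎ IsPairVia x y (table x y)

  pairsVia? : ∀ table → Dec (PairsVia table)
  pairsVia? table = all? λ x → all? λ y → (x ≟ y) ⊎-dec isPairVia? x y (table x y)

  rainbowTwoConnected : ∀ table → PairsVia table → RainbowTwoConnected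
  rainbowTwoConnected table pairs x y x≢y with pairs x y
  ... | inj₁ x≡y = ⊥-elim (x≢y x≡y)
  ... | inj₂ P = toPair (table x y) P

wellFormed? : (T : Template) (k : ℕ) → Dec (WellFormed T k)
wellFormed? T k = map′
  (λ (p , as , ai , gs , gi , cs , gcs , c< , a< , g<) → record
     { size-positive = p ; coreAdj-sym = as ; coreAdj-irrefl = ai ; gadgetAdj-sym = gs ; gadgetAdj-irrefl = gi
     ; coreCol-sym = cs ; gadgetCol-sym = gcs ; coreCol-< = c< ; attachCol-< = a< ; gadgetCol-< = g< })
  (λ P → let open WellFormed P in size-positive , coreAdj-sym , coreAdj-irrefl , gadgetAdj-sym , gadgetAdj-irrefl ,
     coreCol-sym , gadgetCol-sym , coreCol-< , attachCol-< , gadgetCol-<)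
  (0 <? size
    ×-dec all? (λ a → all? λ b → coreAdj a b Bool.≟ coreAdj b a)
    ×-dec all? (λ a → coreAdj a a Bool.≟ false)
    ×-dec all? (λ t → all? λ u → gadgetAdj t u Bool.≟ gadgetAdj u t)
    ×-dec all? (λ t → gadgetAdj t t Bool.≟ false)
    ×-dec all? (λ a → all? λ b → coreCol a b ℕ.≟ coreCol b a)
    ×-dec all? (λ t → all? λ u → gadgetCol t u ℕ.≟ gadgetCol u t)
    ×-dec all? (λ a → all? λ b → coreCol a b <? k)
    ×-dec all? (λ a → all? λ t → attachCol a t <? k)
    ×-dec all? (λ t → all? λ u → gadgetCol t u <? k))
  where open Template T

module Certify (T : Template) where
  open Template T
  open Local T
  private
    module One = RainbowPaths oneAdj oneCol
    module DOne = Decide oneAdj oneCol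
    module DTwo = Decide twoAdj twoCol

  LocalRainbowVia : (Fin (c + s) → Fin (c + s) → Paths (c + s)) → (Fin s → Fin s → Paths (c + (s + s))) → Set
  LocalRainbowVia one two = DOne.PairsVia one × (∀ t t′ → DTwo.IsPairVia (c ↑ʳ (t ↑ˡ s)) (c ↑ʳ (s ↑ʳ t′)) (two t t′))

  localRainbowVia? : ∀ one two → Dec (LocalRainbowVia one two)
  localRainbowVia? one two = DOne.pairsVia? one ×-dec all? λ t → all? λ t′ → DTwo.isPairVia? _ _ (two t t′)

  localRainbow : ∀ {one two} → LocalRainbowVia one two → LocalRainbow T
  localRainbow {one} {two} (ones , twos) = record
    { oneCopy = DOne.rainbowTwoConnected one ones
    ; twoCopies = λ t t′ → DTwo.toPair (two t t′) (twos t t′)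
    }

  module _ (cf cl base : ℕ) where
    open LocalConditions T cf cl base

    IsRouteVia : List (Fin (c + s)) → Set
    IsRouteVia R = One.RainbowVia hubA R hubB × All.All (λ x → x < base × x ≢ cf × x ≢ cl) (One.colours (One.via hubA R hubB))

    IsToHubsVia : Fin (c + s) → Paths (c + s) → Set
    IsToHubsVia y (toA , toB) = One.RainbowVia y toA hubA × One.RainbowVia y toB hubB × hubB ∉ toA × hubA ∉ toB
      × Disjoint toA toB
      × All.All (λ x → x < base × x ≢ cf) (One.colours (One.via y toA hubA))
      × All.All (λ x → x < base × x ≢ cl) (One.colours (One.via y toB hubB))

    SpineCompatibleVia : List (Fin (c + s)) → (Fin (c + s) → Paths (c + s)) → Set
    SpineCompatibleVia R halves = cf < base × cl < base × cf ≢ cl × IsRouteVia R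
      × (∀ y → y ≡ hubA ⊎ y ≡ hubB ⊎ IsToHubsVia y (halves y))

    spineCompatibleVia? : ∀ R halves → Dec (SpineCompatibleVia R halves)
    spineCompatibleVia? R halves = cf <? base ×-dec cl <? base ×-dec ¬? (cf ℕ.≟ cl)
      ×-dec (DOne.rainbowPath? _ ×-dec All.all? (λ x → x <? base ×-dec ¬? (x ℕ.≟ cf) ×-dec ¬? (x ℕ.≟ cl)) _)
      ×-dec all? λ y → y ≟ hubA ⊎-dec y ≟ hubB ⊎-dec
        (DOne.rainbowPath? _ ×-dec DOne.rainbowPath? _ ×-dec ¬? (_∈?_ _≟_ hubB _) ×-dec ¬? (_∈?_ _≟_ hubA _)
          ×-dec disjoint? _≟_ _ _ ×-dec All.all? (λ x → x <? base ×-dec ¬? (x ℕ.≟ cf)) _ ×-dec All.all? (λ x → x <? base ×-dec ¬? (x ℕ.≟ cl)) _)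

    spineCompatible : ∀ {R halves} → SpineCompatibleVia R halves → SpineCompatible
    spineCompatible {R} {halves} (cf< , cl< , cf≢cl , (route-ok , route-cols) , hubs) = record
      { cf<base = cf< ; cl<base = cl< ; cf≢cl = cf≢cl
      ; route = R ; route-rainbow = route-ok ; route-colours = All.lookup route-cols
      ; toHubs = toHubs
      }
      where
      toHubs : ∀ y → y ≢ hubA → y ≢ hubB → ToHubs y
      toHubs y y≢A y≢B with hubs y
      ... | inj₁ y≡A = ⊥-elim (y≢A y≡A)
      ... | inj₂ (inj₁ y≡B) = ⊥-elim (y≢B y≡B)
      ... | inj₂ (inj₂ (pA , pB , B∉ , A∉ , A#B , colsA , colsB)) = record
        { toA = proj₁ (halves y) ; toB = proj₂ (halves y)
        ; toA-rainbow = pA ; toB-rainbow = pB ; hubB∉toA = B∉ ; hubA∉toB = A∉ ; toA#toB = A#B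
        ; toA-colours = All.lookup colsA ; toB-colours = All.lookup colsB
        }

certify : ∀ T k e one two → True (wellFormed? T k) → True (Certify.localRainbowVia? T one two) →
          length (Arcs.coreArcs T) ≡ 4 * Template.extra T → length (Arcs.gadgetArcs T) ≡ 2 * e → Certificate T k e
certify T k e one two wellFormed local core gadget = record
  { wellFormed = toWitness wellFormed
  ; local = Certify.localRainbow T (toWitness local)
  ; coreArcs-length = core
  ; gadgetArcs-length = gadget
  }

onℕ : ∀ {a b} {A : Set} → (ℕ → ℕ → A) → Fin a → Fin b → A
onℕ f x y = f (toℕ x) (toℕ y)

coreAdj₁ : ℕ → ℕ → Bool
coreAdj₁ 0 2 = true
coreAdj₁ 1 2 = true
coreAdj₁ 2 0 = true
coreAdj₁ 2 1 = true
coreAdj₁ _ _ = false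

attachAdj₁ : ℕ → ℕ → Bool
attachAdj₁ 0 _ = true
attachAdj₁ 1 _ = true
attachAdj₁ _ _ = false

attachCol₁ : ℕ → ℕ → ℕ
attachCol₁ 0 0 = 0
attachCol₁ 1 1 = 0
attachCol₁ _ _ = 1

gadgetAdj₁ : ℕ → ℕ → Bool
gadgetAdj₁ 0 1 = true
gadgetAdj₁ 1 0 = true
gadgetAdj₁ _ _ = false

template₁ : ℕ → Template
template₁ q = record
  { extra = q ; size = 2
  ; coreAdj = onℕ coreAdj₁ ; coreCol = λ _ _ → 2
  ; attachAdj = onℕ attachAdj₁ ; attachCol = onℕ attachCol₁
  ; gadgetAdj = onℕ gadgetAdj₁ ; gadgetCol = λ _ _ → 2
  }

extraToA extraToB : ℕ → ℕ
extraToA 0 = 1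
extraToA 1 = 2
extraToA _ = 3
extraToB 0 = 0
extraToB 1 = 2
extraToB _ = 3

coreAdj₂ : ℕ → ℕ → Bool
coreAdj₂ 0 (suc (suc _)) = true
coreAdj₂ 1 (suc (suc _)) = true
coreAdj₂ (suc (suc _)) 0 = true
coreAdj₂ (suc (suc _)) 1 = true
coreAdj₂ _ _ = false

coreCol₂ : ℕ → ℕ → ℕ
coreCol₂ 0 (suc (suc k)) = extraToA k
coreCol₂ 1 (suc (suc k)) = extraToB k
coreCol₂ (suc (suc k)) 0 = extraToA k
coreCol₂ (suc (suc k)) 1 = extraToB k
coreCol₂ _ _ = 0

attachAdj₂ : ℕ → ℕ → Bool
attachAdj₂ 0 0 = true
attachAdj₂ 0 2 = true
attachAdj₂ 1 1 = true
attachAdj₂ 1 3 = true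
attachAdj₂ _ _ = false

attachCol₂ : ℕ → ℕ → ℕ
attachCol₂ 0 0 = 3
attachCol₂ 1 1 = 3
attachCol₂ _ _ = 4

gadgetAdj₂ : ℕ → ℕ → Bool
gadgetAdj₂ 0 1 = true
gadgetAdj₂ 1 0 = true
gadgetAdj₂ 1 2 = true
gadgetAdj₂ 2 1 = true
gadgetAdj₂ 2 3 = true
gadgetAdj₂ 3 2 = true
gadgetAdj₂ 0 3 = true
gadgetAdj₂ 3 0 = true
gadgetAdj₂ _ _ = false

gadgetCol₂ : ℕ → ℕ → ℕ
gadgetCol₂ 1 2 = 1
gadgetCol₂ 2 1 = 1
gadgetCol₂ 0 3 = 2
gadgetCol₂ 3 0 = 2
gadgetCol₂ _ _ = 0

template₂ : ℕ → Template
template₂ q = record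
  { extra = q ; size = 4
  ; coreAdj = onℕ coreAdj₂ ; coreCol = onℕ coreCol₂
  ; attachAdj = onℕ attachAdj₂ ; attachCol = onℕ attachCol₂
  ; gadgetAdj = onℕ gadgetAdj₂ ; gadgetCol = onℕ gadgetCol₂
  }

Grid : ℕ → ℕ → Set
Grid n k = Vec (Vec (Paths k) n) n

Table : ℕ → Set
Table k = Grid k k

entry : ∀ {n k} → Grid n k → Fin n → Fin n → Paths k
entry T x y = lookup (lookup T x) y

module TwoCopyVertices (q s : ℕ) where
  A B : Fin (2 + q + (s + s))
  A = Fin.zero
  B = Fin.suc Fin.zero

  L R : Fin s → Fin (2 + q + (s + s))
  L t = (2 + q) ↑ʳ (t ↑ˡ s)
  R t = (2 + q) ↑ʳ (s ↑ʳ t)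

twoCopies₁ : ∀ q → Fin 2 → Fin 2 → Paths (2 + q + (2 + 2))
twoCopies₁ q = entry (
    ((A ∷ R (# 1) ∷ [] , L (# 1) ∷ B ∷ []) ∷ (A ∷ [] , B ∷ []) ∷ [])
  ∷ ((A ∷ [] , B ∷ []) ∷ (A ∷ R (# 0) ∷ [] , L (# 0) ∷ B ∷ []) ∷ [])
  ∷ [])
  where open TwoCopyVertices q 2

twoCopies₂ : ∀ q → Fin 4 → Fin 4 → Paths (2 + q + (4 + 4))
twoCopies₂ q = entry (
    ((A ∷ R (# 2) ∷ R (# 1) ∷ [] , L (# 1) ∷ B ∷ R (# 3) ∷ []) ∷ (A ∷ R (# 2) ∷ [] , L (# 3) ∷ B ∷ [])
       ∷ (A ∷ [] , L (# 3) ∷ B ∷ R (# 1) ∷ []) ∷ (A ∷ R (# 2) ∷ [] , L (# 1) ∷ B ∷ []) ∷ [])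
  ∷ ((B ∷ R (# 3) ∷ [] , L (# 2) ∷ A ∷ []) ∷ (B ∷ R (# 3) ∷ R (# 0) ∷ [] , L (# 0) ∷ A ∷ R (# 2) ∷ [])
       ∷ (B ∷ R (# 3) ∷ [] , L (# 0) ∷ A ∷ []) ∷ (B ∷ [] , L (# 2) ∷ A ∷ R (# 0) ∷ []) ∷ [])
  ∷ ((A ∷ [] , L (# 1) ∷ B ∷ R (# 3) ∷ []) ∷ (A ∷ R (# 0) ∷ [] , L (# 3) ∷ B ∷ [])
       ∷ (A ∷ R (# 0) ∷ R (# 1) ∷ [] , L (# 1) ∷ B ∷ R (# 3) ∷ []) ∷ (A ∷ R (# 0) ∷ [] , L (# 1) ∷ B ∷ []) ∷ [])
  ∷ ((B ∷ R (# 1) ∷ [] , L (# 2) ∷ A ∷ []) ∷ (B ∷ [] , L (# 0) ∷ A ∷ R (# 2) ∷ [])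
       ∷ (B ∷ R (# 1) ∷ [] , L (# 0) ∷ A ∷ []) ∷ (B ∷ R (# 1) ∷ R (# 0) ∷ [] , L (# 0) ∷ A ∷ R (# 2) ∷ []) ∷ [])
  ∷ [])
  where open TwoCopyVertices q 4

route₂ : ∀ q → List (Fin (2 + q + 4))
route₂ q = ((2 + q) ↑ʳ # 0) ∷ ((2 + q) ↑ʳ # 3) ∷ []

toHubs₂ : ∀ q → Fin (2 + q + 4) → Paths (2 + q + 4)
toHubs₂ q y with splitAt (2 + q) y
... | inj₁ _ = [] , []
... | inj₂ t = lookup (([] , G (# 1) ∷ []) ∷ (G (# 2) ∷ [] , []) ∷ ([] , G (# 3) ∷ []) ∷ (G (# 0) ∷ [] , []) ∷ []) t
  where
  G : Fin 4 → Fin (2 + q + 4)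
  G t = (2 + q) ↑ʳ t

-- Row x, column y of a table lists the interiors of two internally disjoint rainbow x–y paths.
-- Vertices are numbered as in Fin (c + s): A = 0, B = 1, the extra core vertices, then the gadget.
oneCopy₁₀ : Table 4
oneCopy₁₀ =
    (([] , []) ∷ (# 2 ∷ [] , # 3 ∷ []) ∷ ([] , # 3 ∷ []) ∷ ([] , # 2 ∷ []) ∷ [])
  ∷ ((# 2 ∷ [] , # 3 ∷ []) ∷ ([] , []) ∷ ([] , # 3 ∷ []) ∷ ([] , # 2 ∷ []) ∷ [])
  ∷ (([] , # 3 ∷ []) ∷ ([] , # 3 ∷ []) ∷ ([] , []) ∷ ([] , # 0 ∷ []) ∷ [])
  ∷ (([] , # 2 ∷ []) ∷ ([] , # 2 ∷ []) ∷ ([] , # 0 ∷ []) ∷ ([] , []) ∷ [])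
  ∷ []

oneCopy₁₁ : Table 5
oneCopy₁₁ =
    (([] , []) ∷ (# 3 ∷ [] , # 4 ∷ []) ∷ ([] , # 3 ∷ # 1 ∷ []) ∷ ([] , # 4 ∷ []) ∷ ([] , # 3 ∷ []) ∷ [])
  ∷ ((# 3 ∷ [] , # 4 ∷ []) ∷ ([] , []) ∷ ([] , # 3 ∷ # 0 ∷ []) ∷ ([] , # 4 ∷ []) ∷ ([] , # 3 ∷ []) ∷ [])
  ∷ (([] , # 1 ∷ # 3 ∷ []) ∷ ([] , # 0 ∷ # 3 ∷ []) ∷ ([] , []) ∷ (# 0 ∷ [] , # 1 ∷ []) ∷ (# 0 ∷ [] , # 1 ∷ []) ∷ [])
  ∷ (([] , # 4 ∷ []) ∷ ([] , # 4 ∷ []) ∷ (# 0 ∷ [] , # 1 ∷ []) ∷ ([] , []) ∷ ([] , # 0 ∷ []) ∷ [])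
  ∷ (([] , # 3 ∷ []) ∷ ([] , # 3 ∷ []) ∷ (# 0 ∷ [] , # 1 ∷ []) ∷ ([] , # 0 ∷ []) ∷ ([] , []) ∷ [])
  ∷ []

oneCopy₂₀ : Table 6
oneCopy₂₀ =
    (([] , []) ∷ (# 2 ∷ # 5 ∷ [] , # 4 ∷ # 3 ∷ []) ∷ ([] , # 4 ∷ # 3 ∷ []) ∷ (# 2 ∷ [] , # 4 ∷ []) ∷ ([] , # 2 ∷ # 3 ∷ []) ∷ (# 2 ∷ [] , # 4 ∷ []) ∷ [])
  ∷ ((# 3 ∷ # 4 ∷ [] , # 5 ∷ # 2 ∷ []) ∷ ([] , []) ∷ (# 3 ∷ [] , # 5 ∷ []) ∷ ([] , # 5 ∷ # 2 ∷ []) ∷ (# 3 ∷ [] , # 5 ∷ []) ∷ ([] , # 3 ∷ # 2 ∷ []) ∷ [])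
  ∷ (([] , # 3 ∷ # 4 ∷ []) ∷ (# 3 ∷ [] , # 5 ∷ []) ∷ ([] , []) ∷ ([] , # 0 ∷ # 4 ∷ []) ∷ (# 0 ∷ [] , # 3 ∷ []) ∷ ([] , # 0 ∷ # 4 ∷ []) ∷ [])
  ∷ ((# 2 ∷ [] , # 4 ∷ []) ∷ ([] , # 2 ∷ # 5 ∷ []) ∷ ([] , # 1 ∷ # 5 ∷ []) ∷ ([] , []) ∷ ([] , # 1 ∷ # 5 ∷ []) ∷ (# 1 ∷ [] , # 2 ∷ []) ∷ [])
  ∷ (([] , # 3 ∷ # 2 ∷ []) ∷ (# 3 ∷ [] , # 5 ∷ []) ∷ (# 0 ∷ [] , # 3 ∷ []) ∷ ([] , # 0 ∷ # 2 ∷ []) ∷ ([] , []) ∷ ([] , # 0 ∷ # 2 ∷ []) ∷ [])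
  ∷ ((# 2 ∷ [] , # 4 ∷ []) ∷ ([] , # 2 ∷ # 3 ∷ []) ∷ ([] , # 1 ∷ # 3 ∷ []) ∷ (# 1 ∷ [] , # 2 ∷ []) ∷ ([] , # 1 ∷ # 3 ∷ []) ∷ ([] , []) ∷ [])
  ∷ []

oneCopy₂₁ : Table 7
oneCopy₂₁ =
    (([] , []) ∷ (# 2 ∷ [] , # 3 ∷ # 6 ∷ []) ∷ ([] , # 3 ∷ # 6 ∷ # 1 ∷ []) ∷ ([] , # 5 ∷ # 4 ∷ []) ∷ (# 3 ∷ [] , # 5 ∷ []) ∷ ([] , # 3 ∷ # 4 ∷ []) ∷ (# 3 ∷ [] , # 5 ∷ []) ∷ [])
  ∷ ((# 2 ∷ [] , # 4 ∷ # 5 ∷ []) ∷ ([] , []) ∷ ([] , # 6 ∷ # 3 ∷ # 0 ∷ []) ∷ (# 4 ∷ [] , # 6 ∷ []) ∷ ([] , # 6 ∷ # 3 ∷ []) ∷ (# 4 ∷ [] , # 6 ∷ []) ∷ ([] , # 4 ∷ # 3 ∷ []) ∷ [])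
  ∷ (([] , # 1 ∷ # 4 ∷ # 5 ∷ []) ∷ ([] , # 0 ∷ # 3 ∷ # 6 ∷ []) ∷ ([] , []) ∷ (# 0 ∷ [] , # 1 ∷ # 6 ∷ []) ∷ (# 1 ∷ [] , # 0 ∷ # 3 ∷ []) ∷ (# 0 ∷ [] , # 1 ∷ # 4 ∷ []) ∷ (# 1 ∷ [] , # 0 ∷ # 3 ∷ []) ∷ [])
  ∷ (([] , # 4 ∷ # 5 ∷ []) ∷ (# 4 ∷ [] , # 6 ∷ []) ∷ (# 0 ∷ [] , # 6 ∷ # 1 ∷ []) ∷ ([] , []) ∷ ([] , # 0 ∷ # 5 ∷ []) ∷ (# 0 ∷ [] , # 4 ∷ []) ∷ ([] , # 0 ∷ # 5 ∷ []) ∷ [])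
  ∷ ((# 3 ∷ [] , # 5 ∷ []) ∷ ([] , # 3 ∷ # 6 ∷ []) ∷ (# 1 ∷ [] , # 3 ∷ # 0 ∷ []) ∷ ([] , # 1 ∷ # 6 ∷ []) ∷ ([] , []) ∷ ([] , # 1 ∷ # 6 ∷ []) ∷ (# 1 ∷ [] , # 3 ∷ []) ∷ [])
  ∷ (([] , # 4 ∷ # 3 ∷ []) ∷ (# 4 ∷ [] , # 6 ∷ []) ∷ (# 0 ∷ [] , # 4 ∷ # 1 ∷ []) ∷ (# 0 ∷ [] , # 4 ∷ []) ∷ ([] , # 0 ∷ # 3 ∷ []) ∷ ([] , []) ∷ ([] , # 0 ∷ # 3 ∷ []) ∷ [])
  ∷ ((# 3 ∷ [] , # 5 ∷ []) ∷ ([] , # 3 ∷ # 4 ∷ []) ∷ (# 1 ∷ [] , # 3 ∷ # 0 ∷ []) ∷ ([] , # 1 ∷ # 4 ∷ []) ∷ (# 1 ∷ [] , # 3 ∷ []) ∷ ([] , # 1 ∷ # 4 ∷ []) ∷ ([] , []) ∷ [])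
  ∷ []

oneCopy₂₂ : Table 8
oneCopy₂₂ =
    (([] , []) ∷ (# 2 ∷ [] , # 4 ∷ # 7 ∷ []) ∷ ([] , # 4 ∷ # 7 ∷ # 1 ∷ []) ∷ ([] , # 2 ∷ # 1 ∷ []) ∷ ([] , # 6 ∷ # 5 ∷ []) ∷ (# 4 ∷ [] , # 6 ∷ []) ∷ ([] , # 4 ∷ # 5 ∷ []) ∷ (# 4 ∷ [] , # 6 ∷ []) ∷ [])
  ∷ ((# 2 ∷ [] , # 5 ∷ # 6 ∷ []) ∷ ([] , []) ∷ ([] , # 7 ∷ # 4 ∷ # 0 ∷ []) ∷ ([] , # 2 ∷ # 0 ∷ []) ∷ (# 5 ∷ [] , # 7 ∷ []) ∷ ([] , # 7 ∷ # 4 ∷ []) ∷ (# 5 ∷ [] , # 7 ∷ []) ∷ ([] , # 5 ∷ # 4 ∷ []) ∷ [])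
  ∷ (([] , # 1 ∷ # 5 ∷ # 6 ∷ []) ∷ ([] , # 0 ∷ # 4 ∷ # 7 ∷ []) ∷ ([] , []) ∷ (# 0 ∷ [] , # 1 ∷ []) ∷ (# 0 ∷ [] , # 1 ∷ # 7 ∷ []) ∷ (# 1 ∷ [] , # 0 ∷ # 4 ∷ []) ∷ (# 0 ∷ [] , # 1 ∷ # 5 ∷ []) ∷ (# 1 ∷ [] , # 0 ∷ # 4 ∷ []) ∷ [])
  ∷ (([] , # 1 ∷ # 2 ∷ []) ∷ ([] , # 0 ∷ # 2 ∷ []) ∷ (# 0 ∷ [] , # 1 ∷ []) ∷ ([] , []) ∷ (# 0 ∷ [] , # 1 ∷ # 5 ∷ []) ∷ (# 1 ∷ [] , # 0 ∷ # 4 ∷ []) ∷ (# 0 ∷ [] , # 1 ∷ # 5 ∷ []) ∷ (# 1 ∷ [] , # 0 ∷ # 6 ∷ []) ∷ [])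
  ∷ (([] , # 5 ∷ # 6 ∷ []) ∷ (# 5 ∷ [] , # 7 ∷ []) ∷ (# 0 ∷ [] , # 7 ∷ # 1 ∷ []) ∷ (# 0 ∷ [] , # 5 ∷ # 1 ∷ []) ∷ ([] , []) ∷ ([] , # 0 ∷ # 6 ∷ []) ∷ (# 0 ∷ [] , # 5 ∷ []) ∷ ([] , # 0 ∷ # 6 ∷ []) ∷ [])
  ∷ ((# 4 ∷ [] , # 6 ∷ []) ∷ ([] , # 4 ∷ # 7 ∷ []) ∷ (# 1 ∷ [] , # 4 ∷ # 0 ∷ []) ∷ (# 1 ∷ [] , # 4 ∷ # 0 ∷ []) ∷ ([] , # 1 ∷ # 7 ∷ []) ∷ ([] , []) ∷ ([] , # 1 ∷ # 7 ∷ []) ∷ (# 1 ∷ [] , # 4 ∷ []) ∷ [])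
  ∷ (([] , # 5 ∷ # 4 ∷ []) ∷ (# 5 ∷ [] , # 7 ∷ []) ∷ (# 0 ∷ [] , # 5 ∷ # 1 ∷ []) ∷ (# 0 ∷ [] , # 5 ∷ # 1 ∷ []) ∷ (# 0 ∷ [] , # 5 ∷ []) ∷ ([] , # 0 ∷ # 4 ∷ []) ∷ ([] , []) ∷ ([] , # 0 ∷ # 4 ∷ []) ∷ [])
  ∷ ((# 4 ∷ [] , # 6 ∷ []) ∷ ([] , # 4 ∷ # 5 ∷ []) ∷ (# 1 ∷ [] , # 4 ∷ # 0 ∷ []) ∷ (# 1 ∷ [] , # 6 ∷ # 0 ∷ []) ∷ ([] , # 1 ∷ # 5 ∷ []) ∷ (# 1 ∷ [] , # 4 ∷ []) ∷ ([] , # 1 ∷ # 5 ∷ []) ∷ ([] , []) ∷ [])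
  ∷ []

oneCopy₂₃ : Table 9
oneCopy₂₃ =
    (([] , []) ∷ (# 2 ∷ [] , # 5 ∷ # 8 ∷ []) ∷ ([] , # 5 ∷ # 8 ∷ # 1 ∷ []) ∷ ([] , # 2 ∷ # 1 ∷ []) ∷ ([] , # 2 ∷ # 1 ∷ []) ∷ ([] , # 7 ∷ # 6 ∷ []) ∷ (# 5 ∷ [] , # 7 ∷ []) ∷ ([] , # 5 ∷ # 6 ∷ []) ∷ (# 5 ∷ [] , # 7 ∷ []) ∷ [])
  ∷ ((# 2 ∷ [] , # 6 ∷ # 7 ∷ []) ∷ ([] , []) ∷ ([] , # 8 ∷ # 5 ∷ # 0 ∷ []) ∷ ([] , # 2 ∷ # 0 ∷ []) ∷ ([] , # 2 ∷ # 0 ∷ []) ∷ (# 6 ∷ [] , # 8 ∷ []) ∷ ([] , # 8 ∷ # 5 ∷ []) ∷ (# 6 ∷ [] , # 8 ∷ []) ∷ ([] , # 6 ∷ # 5 ∷ []) ∷ [])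
  ∷ (([] , # 1 ∷ # 6 ∷ # 7 ∷ []) ∷ ([] , # 0 ∷ # 5 ∷ # 8 ∷ []) ∷ ([] , []) ∷ (# 0 ∷ [] , # 1 ∷ []) ∷ (# 0 ∷ [] , # 1 ∷ []) ∷ (# 0 ∷ [] , # 1 ∷ # 8 ∷ []) ∷ (# 1 ∷ [] , # 0 ∷ # 5 ∷ []) ∷ (# 0 ∷ [] , # 1 ∷ # 6 ∷ []) ∷ (# 1 ∷ [] , # 0 ∷ # 5 ∷ []) ∷ [])
  ∷ (([] , # 1 ∷ # 2 ∷ []) ∷ ([] , # 0 ∷ # 2 ∷ []) ∷ (# 0 ∷ [] , # 1 ∷ []) ∷ ([] , []) ∷ (# 0 ∷ [] , # 1 ∷ []) ∷ (# 0 ∷ [] , # 1 ∷ # 6 ∷ []) ∷ (# 1 ∷ [] , # 0 ∷ # 5 ∷ []) ∷ (# 0 ∷ [] , # 1 ∷ # 6 ∷ []) ∷ (# 1 ∷ [] , # 0 ∷ # 7 ∷ []) ∷ [])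
  ∷ (([] , # 1 ∷ # 2 ∷ []) ∷ ([] , # 0 ∷ # 2 ∷ []) ∷ (# 0 ∷ [] , # 1 ∷ []) ∷ (# 0 ∷ [] , # 1 ∷ []) ∷ ([] , []) ∷ (# 1 ∷ # 8 ∷ [] , # 0 ∷ # 7 ∷ # 6 ∷ []) ∷ (# 0 ∷ # 7 ∷ [] , # 1 ∷ # 8 ∷ # 5 ∷ []) ∷ (# 0 ∷ [] , # 1 ∷ # 8 ∷ []) ∷ (# 1 ∷ [] , # 0 ∷ # 7 ∷ []) ∷ [])
  ∷ (([] , # 6 ∷ # 7 ∷ []) ∷ (# 6 ∷ [] , # 8 ∷ []) ∷ (# 0 ∷ [] , # 8 ∷ # 1 ∷ []) ∷ (# 0 ∷ [] , # 6 ∷ # 1 ∷ []) ∷ (# 8 ∷ # 1 ∷ [] , # 6 ∷ # 7 ∷ # 0 ∷ []) ∷ ([] , []) ∷ ([] , # 0 ∷ # 7 ∷ []) ∷ (# 0 ∷ [] , # 6 ∷ []) ∷ ([] , # 0 ∷ # 7 ∷ []) ∷ [])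
  ∷ ((# 5 ∷ [] , # 7 ∷ []) ∷ ([] , # 5 ∷ # 8 ∷ []) ∷ (# 1 ∷ [] , # 5 ∷ # 0 ∷ []) ∷ (# 1 ∷ [] , # 5 ∷ # 0 ∷ []) ∷ (# 7 ∷ # 0 ∷ [] , # 5 ∷ # 8 ∷ # 1 ∷ []) ∷ ([] , # 1 ∷ # 8 ∷ []) ∷ ([] , []) ∷ ([] , # 1 ∷ # 8 ∷ []) ∷ (# 1 ∷ [] , # 5 ∷ []) ∷ [])
  ∷ (([] , # 6 ∷ # 5 ∷ []) ∷ (# 6 ∷ [] , # 8 ∷ []) ∷ (# 0 ∷ [] , # 6 ∷ # 1 ∷ []) ∷ (# 0 ∷ [] , # 6 ∷ # 1 ∷ []) ∷ (# 0 ∷ [] , # 8 ∷ # 1 ∷ []) ∷ (# 0 ∷ [] , # 6 ∷ []) ∷ ([] , # 0 ∷ # 5 ∷ []) ∷ ([] , []) ∷ ([] , # 0 ∷ # 5 ∷ []) ∷ [])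
  ∷ ((# 5 ∷ [] , # 7 ∷ []) ∷ ([] , # 5 ∷ # 6 ∷ []) ∷ (# 1 ∷ [] , # 5 ∷ # 0 ∷ []) ∷ (# 1 ∷ [] , # 7 ∷ # 0 ∷ []) ∷ (# 1 ∷ [] , # 7 ∷ # 0 ∷ []) ∷ ([] , # 1 ∷ # 6 ∷ []) ∷ (# 1 ∷ [] , # 5 ∷ []) ∷ ([] , # 1 ∷ # 6 ∷ []) ∷ ([] , []) ∷ [])
  ∷ []

certificate₁ : ∀ q → q < 2 → Certificate (template₁ q) 3 5
certificate₁ 0 _ = certify (template₁ 0) 3 5 (entry oneCopy₁₀) (twoCopies₁ 0) _ _ refl refl
certificate₁ 1 _ = certify (template₁ 1) 3 5 (entry oneCopy₁₁) (twoCopies₁ 1) _ _ refl refl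
certificate₁ (suc (suc _)) (s≤s (s≤s ()))

certificate₂ : ∀ q → q < 4 → Certificate (template₂ q) 5 8
certificate₂ 0 _ = certify (template₂ 0) 5 8 (entry oneCopy₂₀) (twoCopies₂ 0) _ _ refl refl
certificate₂ 1 _ = certify (template₂ 1) 5 8 (entry oneCopy₂₁) (twoCopies₂ 1) _ _ refl refl
certificate₂ 2 _ = certify (template₂ 2) 5 8 (entry oneCopy₂₂) (twoCopies₂ 2) _ _ refl refl
certificate₂ 3 _ = certify (template₂ 3) 5 8 (entry oneCopy₂₃) (twoCopies₂ 3) _ _ refl refl
certificate₂ (suc (suc (suc (suc _)))) (s≤s (s≤s (s≤s (s≤s ()))))

spineCompatible₂ : ∀ q → q < 4 → LocalConditions.SpineCompatible (template₂ q) 0 1 5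
spineCompatible₂ q q<4 = Certify.spineCompatible (template₂ q) 0 1 5 {route₂ q} {toHubs₂ q} (toWitness (check q q<4))
  where
  check : ∀ q → q < 4 → True (Certify.spineCompatibleVia? (template₂ q) 0 1 5 (route₂ q) (toHubs₂ q))
  check 0 _ = _
  check 1 _ = _
  check 2 _ = _
  check 3 _ = _
  check (suc (suc (suc (suc _)))) (s≤s (s≤s (s≤s (s≤s ()))))

divide-positive : ∀ s n .{{_ : NonZero s}} → s ≤ n → Σ[ q ∈ ℕ ] Σ[ g′ ∈ ℕ ] (q < s × n ≡ q + suc g′ * s)
divide-positive s n s≤n with n / s | m≥n⇒m/n>0 {n} {s} s≤n | m≡m%n+[m/n]*n n s
... | suc g′ | _ | n≡ = n % s , g′ , m%n<n n s , n≡

hubGraph-order : ∀ {n} q G m → 2 + m ≤ n → n ∸ (2 + m) ≡ q + G → 2 + q + (G + m) ≡ n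
hubGraph-order {n} q G m 2+m≤n n∸≡ = trans (shuffle q G m) (trans (cong (2 + m +_) (sym n∸≡)) (m+[n∸m]≡n 2+m≤n))
  where
  shuffle : ∀ q G m → 2 + q + (G + m) ≡ 2 + m + (q + G)
  shuffle = solve-∀

family₁ : ∀ r n → 3 ≤ r → 4 ≤ n → (B : ℕ → Set) →
          (∀ q g e → n ≡ 2 + q + (g * 2 + 0) → e ≤ 2 * q + (g * 5 + 0) → B e) → T2Bound n r B
family₁ r n 3≤r 4≤n B bound with divide-positive 2 (n ∸ 2) (∸-monoˡ-≤ 2 4≤n)
... | q , g′ , q<2 , n∸2≡ = T2Bound-map (λ e → bound q (suc g′) e (sym n≡))
    (subst (λ n → T2Bound n r (λ E → E ≤ 2 * q + (suc g′ * 5 + 0))) n≡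
      (hubGraph (certificate₁ q q<2) g′ 0 0 1 0 r (λ ()) 3≤r (≤-trans (s≤s z≤n) 3≤r) (≤-trans (s≤s (s≤s z≤n)) 3≤r) z≤n))
  where
  n≡ : 2 + q + (suc g′ * 2 + 0) ≡ n
  n≡ = hubGraph-order q (suc g′ * 2) 0 (≤-trans (s≤s (s≤s z≤n)) 4≤n) n∸2≡

family₂ : ∀ m n → 6 + m ≤ n → (B : ℕ → Set) →
          (∀ q g e → n ≡ 2 + q + (g * 4 + m) → e ≤ 2 * q + (g * 8 + spineEdgeCount m) → B e) → T2Bound n (5 + m) B
family₂ m n 6+m≤n B bound
  with divide-positive 4 (n ∸ (2 + m)) (subst (_≤ n ∸ (2 + m)) (m+n∸n≡m 4 (2 + m)) (∸-monoˡ-≤ (2 + m) 6+m≤n))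
... | q , g′ , q<4 , n∸≡ = T2Bound-map (λ e → bound q (suc g′) e (sym n≡))
    (subst (λ n → T2Bound n (5 + m) (λ E → E ≤ 2 * q + (suc g′ * 8 + spineEdgeCount m))) n≡
      (hubGraph (certificate₂ q q<4) g′ m 0 1 5 (5 + m) (λ _ → spineCompatible₂ q q<4)
        (m≤m+n 5 m) (s≤s z≤n) (s≤s (s≤s z≤n)) ≤-refl))
  where
  n≡ : 2 + q + (suc g′ * 4 + m) ≡ n
  n≡ = hubGraph-order q (suc g′ * 4) m (≤-trans (+-monoʳ-≤ 2 (m≤n+m m 4)) 6+m≤n) n∸≡

partI-arithmetic : ∀ {n} q g e → n ≡ 2 + q + (g * 2 + 0) → e ≤ 2 * q + (g * 5 + 0) → 2 * e + 10 ≤ 5 * n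
partI-arithmetic q g e refl e≤ = begin
  2 * e + 10                         ≤⟨ +-monoˡ-≤ 10 (*-monoʳ-≤ 2 e≤) ⟩
  2 * (2 * q + (g * 5 + 0)) + 10      ≤⟨ m≤m+n _ q ⟩
  2 * (2 * q + (g * 5 + 0)) + 10 + q  ≡⟨ identity q g ⟩
  5 * (2 + q + (g * 2 + 0))          ∎
  where
  open ≤-Reasoning
  identity : ∀ q g → 2 * (2 * q + (g * 5 + 0)) + 10 + q ≡ 5 * (2 + q + (g * 2 + 0))
  identity = solve-∀

partI : ∀ r n → r ≡ 3 ⊎ r ≡ 4 → r + 1 ≤ n → T2Bound n r (λ e → 2 * e + 10 ≤ 5 * n)
partI .3 n (inj₁ refl) 4≤n = family₁ 3 n ≤-refl 4≤n _ partI-arithmetic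
partI .4 n (inj₂ refl) 5≤n = family₁ 4 n (n≤1+n 3) (≤-trans (n≤1+n 4) 5≤n) _ partI-arithmetic

partII-arithmetic : ∀ n → 7 ≤ n → ∀ q g e → n ≡ 2 + q + (g * 4 + 0) → e ≤ 2 * q + (g * 8 + 0) → 3 * e + 19 ≤ 7 * n
partII-arithmetic .(2 + q + (g * 4 + 0)) 7≤n q g e refl e≤ = begin
  3 * e + 19                                   ≤⟨ +-monoˡ-≤ 19 (*-monoʳ-≤ 3 e≤) ⟩
  3 * (2 * q + (g * 8 + 0)) + 19                ≡⟨ +-assoc (3 * (2 * q + (g * 8 + 0))) 14 5 ⟨
  3 * (2 * q + (g * 8 + 0)) + 14 + 5            ≤⟨ +-monoʳ-≤ (3 * (2 * q + (g * 8 + 0)) + 14) 5≤q+4g ⟩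
  3 * (2 * q + (g * 8 + 0)) + 14 + (q + (g * 4 + 0)) ≡⟨ identity q g ⟩
  7 * (2 + q + (g * 4 + 0))                    ∎
  where
  open ≤-Reasoning
  5≤q+4g : 5 ≤ q + (g * 4 + 0)
  5≤q+4g = +-cancelˡ-≤ 2 5 _ (subst (7 ≤_) (+-assoc 2 q _) 7≤n)
  identity : ∀ q g → 3 * (2 * q + (g * 8 + 0)) + 14 + (q + (g * 4 + 0)) ≡ 7 * (2 + q + (g * 4 + 0))
  identity = solve-∀

partII : ∀ n → 7 ≤ n → T2Bound n 5 (λ e → 3 * e + 19 ≤ 7 * n)
partII n 7≤n = family₂ 0 n (≤-trans (n≤1+n 6) 7≤n) _ (partII-arithmetic n 7≤n)

partIII-arithmetic : ∀ m′ n q g e → n ≡ 2 + q + (g * 4 + suc m′) → e ≤ 2 * q + (g * 8 + suc (suc m′)) →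
                     e + (5 + suc m′) ≤ 2 * n + 2
partIII-arithmetic m′ .(2 + q + (g * 4 + suc m′)) q g e refl e≤ = begin
  e + (5 + suc m′)                                  ≤⟨ +-monoˡ-≤ (5 + suc m′) e≤ ⟩
  2 * q + (g * 8 + suc (suc m′)) + (5 + suc m′)      ≡⟨ identity m′ q g ⟩
  2 * (2 + q + (g * 4 + suc m′)) + 2                ∎
  where
  open ≤-Reasoning
  identity : ∀ m′ q g → 2 * q + (g * 8 + suc (suc m′)) + (5 + suc m′) ≡ 2 * (2 + q + (g * 4 + suc m′)) + 2
  identity = solve-∀

partIII : ∀ r n → 6 ≤ r → r + 3 ≤ n → T2Bound n r (λ e → e + r ≤ 2 * n + 2)
partIII r n 6≤r r+3≤n = subst (λ r → T2Bound n r (λ e → e + r ≤ 2 * n + 2)) r≡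
  (family₂ (suc m′) n 6+m≤n _ (partIII-arithmetic m′ n))
  where
  m′ : ℕ
  m′ = r ∸ 6
  r≡ : 5 + suc m′ ≡ r
  r≡ = trans (sym (+-suc 5 m′)) (m+[n∸m]≡n 6≤r)
  6+m≤n : 6 + suc m′ ≤ n
  6+m≤n = ≤-trans (≤-reflexive (trans (cong suc r≡) (+-comm 1 r))) (≤-trans (+-monoʳ-≤ r (s≤s z≤n)) r+3≤n)

theorem3p1 :
    (∀ (r n : ℕ) → (r ≡ 3 ⊎ r ≡ 4) → r + 1 ≤ n →
        T2Bound n r (λ e → 2 * e + 10 ≤ 5 * n))
    × (∀ (n : ℕ) → 7 ≤ n →
        T2Bound n 5 (λ e → 3 * e + 19 ≤ 7 * n))
    × (∀ (r n : ℕ) → 6 ≤ r → r + 3 ≤ n →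
        T2Bound n r (λ e → e + r ≤ 2 * n + 2))
theorem3p1 = partI , partII , partIII
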